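{- Let $d\ge 2$, $n\ge 1$ and $1\le k\le d-1$. Let $a_{n,k,l=1}^{(d)}$ be the number of generalized linear diagrams with $n$ blocks of size $d$ having exactly $k$ loops, all of which belong to one and the same block. Let $a_{m,j}^{(d)}$ denote the number of generalized linear diagrams with $m$ blocks of size $d$ having exactly $j$ loops (with $a_{0,0}^{(d)}=1$ and $a_{0,j}^{(d)}=0$ for $j\neq 0$). Then $$ a_{n,k,l=1}^{(d)}=\binom{d-1}{k}\sum_{m=0}^{d-k}\binom{d(n-1)+1-m}{d-k-m}\,a_{n-1,m}^{(d)}. $$
   Context: A generalized linear diagram with $m$ blocks of size $d$ is a partition of the set $\{1,2,\ldots,md\}$ (points on a line) into $m$ unordered blocks, each of size $d$. A loop is a pair of consecutive points $\{i,i+1\}$, $1\le i<md$, lying in the same block; a loop belongs to the block containing its two points. Binomial coefficients $\binom{a}{b}$ are $0$ unless $0\le b\le a$. -}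

module Defs where

open import Data.Nat using (ℕ; zero; suc; _+_; _*_; _∸_; _≡ᵇ_; _<ᵇ_; _≤ᵇ_)
open import Data.Nat.Combinatorics using (_C_)
open import Data.Bool using (Bool; true; false; _∧_; if_then_else_)
open import Data.List using (List; []; _∷_; length; map; concatMap; upTo; filterᵇ)
open import Data.Bool.ListAction using (all; any)
open import Data.Nat.ListAction using (sum)

-- Encoding of a generalized linear diagram with m blocks of size d:
-- the points 1..md are the positions 0..md-1 of a word w ∈ List ℕ of
-- length md; w[p] is the label of the block containing point p+1.
-- Blocks are unordered, so labels are normalised by the standard
-- "restricted growth" convention: blocks are labelled 0,1,2,... in order
-- of their first (leftmost) point.  This is a bijection between
-- set partitions and restricted growth words.

words : ℕ → ℕ → List (List ℕ)
words zero    m = [] ∷ []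
words (suc L) m = concatMap (λ w → map (λ x → x ∷ w) (upTo m)) (words L m)

-- restricted growth: each letter is at most the number of distinct
-- letters seen before it (the first letter is 0, a new block gets the
-- next unused label).  'rgsFrom u w' : u labels used so far.
rgsFrom : ℕ → List ℕ → Bool
rgsFrom u []       = true
rgsFrom u (x ∷ w)  = if x <ᵇ u then rgsFrom u w
                     else (if x ≡ᵇ u then rgsFrom (suc u) w else false)

isRGS : List ℕ → Bool
isRGS = rgsFrom 0

occ : ℕ → List ℕ → ℕ
occ x []       = 0
occ x (y ∷ w)  = if x ≡ᵇ y then suc (occ x w) else occ x w

-- w encodes a partition of {1..md} into m blocks, each of size d
-- (letters are < m by construction of 'words m d').
isDiagram : ℕ → ℕ → List ℕ → Bool
isDiagram m d w = isRGS w ∧ all (λ b → occ b w ≡ᵇ d) (upTo m)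

diagrams : ℕ → ℕ → List (List ℕ)
diagrams m d = filterᵇ (isDiagram m d) (words (m * d) m)

loopBlocks : List ℕ → List ℕ
loopBlocks []            = []
loopBlocks (x ∷ [])      = []
loopBlocks (x ∷ y ∷ w)   = if x ≡ᵇ y then x ∷ loopBlocks (y ∷ w) else loopBlocks (y ∷ w)

loops : List ℕ → ℕ
loops w = length (loopBlocks w)

a : ℕ → ℕ → ℕ → ℕ
a d m j = length (filterᵇ (λ w → loops w ≡ᵇ j) (diagrams m d))

loopsInOneBlock : ℕ → List ℕ → Bool
loopsInOneBlock m w = any (λ b → all (λ x → x ≡ᵇ b) (loopBlocks w)) (upTo m)

aOne : ℕ → ℕ → ℕ → ℕ
aOne d n k = length (filterᵇ (λ w → (loops w ≡ᵇ k) ∧ loopsInOneBlock n w) (diagrams n d))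

-- binomial ( (t - s) choose r ) with integer top t - s: zero if t - s < 0
binomDiff : ℕ → ℕ → ℕ → ℕ
binomDiff t s r = if s ≤ᵇ t then (t ∸ s) C r else 0

rhs : ℕ → ℕ → ℕ → ℕ
rhs d n k = ((d ∸ 1) C k) *
  sum (map (λ m → binomDiff (d * (n ∸ 1) + 1) m (d ∸ k ∸ m) * a d (n ∸ 1) m) (upTo (suc (d ∸ k))))

-- Let w be a diagram with n blocks whose k ≥ 1 loops all lie in one block e. Deleting e leaves a
-- diagram w' with n - 1 blocks on d(n-1) points, and e is recorded by the vector c of the numbers
-- of its points in the d(n-1)+1 gaps of w'; since blocks are labelled by restricted growth, the
-- label of e is then forced, so w ↦ (w', c) is injective. The loops of w are the c_i - 1 loops inside
-- the runs of e together with the loops of w' whose gap receives no point of e. Hence w is counted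
-- exactly when c sums to d, has d - k nonzero entries, and is nonzero in each of the m loop gaps of
-- w'. The support of c can then be chosen in C(d(n-1)+1-m, d-k-m) ways and filled with positive
-- entries summing to d in C(d-1, d-k-1) = C(d-1, k) ways; grouping the w' by m gives the formula.

module Submission where

open import Defs
open import Data.Nat using (ℕ; zero; suc; _+_; _*_; _∸_; _≤_; _<_; z≤n; s≤s; s≤s⁻¹; _≟_; _≡ᵇ_; _<ᵇ_; _≤ᵇ_)
open import Data.Nat.Properties
open import Data.Nat.Combinatorics using (_C_; nCk≡nC[n∸k]; nCk+nC[k+1]≡[n+1]C[k+1])
open import Data.Nat.ListAction using (sum)
open import Data.Nat.ListAction.Properties using (sum-++)
open import Data.Bool using (Bool; true; false; _∧_; not; if_then_else_; T)
open import Data.Bool.ListAction using (all; any)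
import Data.Bool.Properties as Boolₚ
open import Data.List using (List; []; _∷_; length; map; concatMap; upTo; filterᵇ; _++_; replicate)
import Data.List.Properties as Listₚ
open import Data.List.Relation.Unary.All as All using (All; []; _∷_)
import Data.List.Relation.Unary.All.Properties as Allₚ
import Data.List.Relation.Unary.Any.Properties as Anyₚ
open import Data.List.Relation.Unary.Any using (here; there)
open import Data.List.Membership.Propositional using (_∈_)
open import Data.Product using (_×_; _,_; proj₁; proj₂; ∃)
open import Data.Sum using (_⊎_; inj₁; inj₂)
open import Data.Unit using (tt)
open import Data.Empty using (⊥-elim)
open import Function using (_∘_; id; Equivalence)
open import Relation.Nullary using (¬_; yes; no)
open import Relation.Binary.Definitions using (tri<; tri≈; tri>)
open import Relation.Binary.PropositionalEquality
open import Algebra.Properties.CommutativeSemigroup +-commutativeSemigroup using (interchange)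

𝟙 : Bool → ℕ
𝟙 true  = 1
𝟙 false = 0

𝟙-∧ : ∀ a b → 𝟙 (a ∧ b) ≡ 𝟙 a * 𝟙 b
𝟙-∧ true  b = sym (+-identityʳ (𝟙 b))
𝟙-∧ false b = refl

T⇒≡true : ∀ {b} → T b → b ≡ true
T⇒≡true = Equivalence.to Boolₚ.T-≡

≡true⇒T : ∀ {b} → b ≡ true → T b
≡true⇒T = Equivalence.from Boolₚ.T-≡

¬T⇒≡false : ∀ {b} → ¬ T b → b ≡ false
¬T⇒≡false {true}  ¬t = ⊥-elim (¬t tt)
¬T⇒≡false {false} _  = refl

∧-split : ∀ {a b} → a ∧ b ≡ true → a ≡ true × b ≡ true
∧-split {true} {true} refl = refl , refl

∧-intro : ∀ {a b} → a ≡ true → b ≡ true → a ∧ b ≡ true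
∧-intro refl refl = refl

≡true-ext : ∀ {a b} → (a ≡ true → b ≡ true) → (b ≡ true → a ≡ true) → a ≡ b
≡true-ext {true}  {true}  _ _ = refl
≡true-ext {false} {false} _ _ = refl
≡true-ext {true}  {false} f _ = sym (f refl)
≡true-ext {false} {true}  _ g = g refl

module _ {m n : ℕ} where

  ≡ᵇ-true : m ≡ n → (m ≡ᵇ n) ≡ true
  ≡ᵇ-true = T⇒≡true ∘ ≡⇒≡ᵇ m n

  ≡ᵇ-false : m ≢ n → (m ≡ᵇ n) ≡ false
  ≡ᵇ-false m≢n = ¬T⇒≡false (m≢n ∘ ≡ᵇ⇒≡ m n)

  ≡ᵇ-sound : (m ≡ᵇ n) ≡ true → m ≡ n
  ≡ᵇ-sound = ≡ᵇ⇒≡ m n ∘ ≡true⇒T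

  ≡ᵇ-false⇒≢ : (m ≡ᵇ n) ≡ false → m ≢ n
  ≡ᵇ-false⇒≢ e m≡n with () ← trans (sym e) (≡ᵇ-true m≡n)

  <ᵇ-true : m < n → (m <ᵇ n) ≡ true
  <ᵇ-true = T⇒≡true ∘ <⇒<ᵇ

  <ᵇ-false : ¬ m < n → (m <ᵇ n) ≡ false
  <ᵇ-false m≮n = ¬T⇒≡false (m≮n ∘ <ᵇ⇒< m n)

  ≤ᵇ-true : m ≤ n → (m ≤ᵇ n) ≡ true
  ≤ᵇ-true = T⇒≡true ∘ ≤⇒≤ᵇ

  ≤ᵇ-false : ¬ m ≤ n → (m ≤ᵇ n) ≡ false
  ≤ᵇ-false m≰n = ¬T⇒≡false (m≰n ∘ ≤ᵇ⇒≤ m n)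

≡ᵇ-cong-⇔ : ∀ {a b c d} → (a ≡ b → c ≡ d) → (c ≡ d → a ≡ b) → (a ≡ᵇ b) ≡ (c ≡ᵇ d)
≡ᵇ-cong-⇔ f g = ≡true-ext (≡ᵇ-true ∘ f ∘ ≡ᵇ-sound) (≡ᵇ-true ∘ g ∘ ≡ᵇ-sound)

≡ᵇ-refl : ∀ n → (n ≡ᵇ n) ≡ true
≡ᵇ-refl n = ≡ᵇ-true {n} refl

≤ᵇ-suc : ∀ m n → (suc m ≤ᵇ suc n) ≡ (m ≤ᵇ n)
≤ᵇ-suc m n with m ≤? n
... | yes m≤n = trans (≤ᵇ-true (s≤s m≤n)) (sym (≤ᵇ-true m≤n))
... | no  m≰n = trans (≤ᵇ-false (m≰n ∘ s≤s⁻¹)) (sym (≤ᵇ-false m≰n))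

<ᵇ-suc : ∀ m n → (m <ᵇ suc n) ≡ (m ≤ᵇ n)
<ᵇ-suc m n with m ≤? n
... | yes m≤n = trans (<ᵇ-true (s≤s m≤n)) (sym (≤ᵇ-true m≤n))
... | no  m≰n = trans (<ᵇ-false (m≰n ∘ s≤s⁻¹)) (sym (≤ᵇ-false m≰n))

+-≡ᵇ : ∀ a b s → (a + b ≡ᵇ s) ≡ (a ≤ᵇ s) ∧ (b ≡ᵇ s ∸ a)
+-≡ᵇ a b s with a ≤? s
... | no a≰s rewrite ≤ᵇ-false a≰s = ≡ᵇ-false (λ e → a≰s (subst (a ≤_) e (m≤m+n a b)))
... | yes a≤s rewrite ≤ᵇ-true a≤s = ≡true-ext
  (λ e → ≡ᵇ-true (trans (sym (m+n∸m≡n a b)) (cong (_∸ a) (≡ᵇ-sound e))))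
  (λ e → ≡ᵇ-true (trans (cong (a +_) (≡ᵇ-sound e)) (m+[n∸m]≡n a≤s)))

all-upTo⁻ : ∀ (p : ℕ → Bool) n → all p (upTo n) ≡ true → ∀ {i} → i < n → p i ≡ true
all-upTo⁻ p n h i<n = T⇒≡true (Allₚ.applyUpTo⁻ id n (Allₚ.all⁺ p (upTo n) (≡true⇒T h)) i<n)

all-upTo⁺ : ∀ (p : ℕ → Bool) n → (∀ {i} → i < n → p i ≡ true) → all p (upTo n) ≡ true
all-upTo⁺ p n h = T⇒≡true (Allₚ.all⁻ p (Allₚ.applyUpTo⁺₁ id n (≡true⇒T ∘ h)))

any-upTo⁻ : ∀ (p : ℕ → Bool) n → any p (upTo n) ≡ true → ∃ λ i → i < n × p i ≡ true
any-upTo⁻ p n h with i , i<n , pi ← Anyₚ.applyUpTo⁻ id (Anyₚ.any⁻ p (upTo n) (≡true⇒T h)) =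
  i , i<n , T⇒≡true pi

any-upTo⁺ : ∀ (p : ℕ → Bool) n {i} → i < n → p i ≡ true → any p (upTo n) ≡ true
any-upTo⁺ p n i<n pi = T⇒≡true (Anyₚ.any⁺ p (Anyₚ.applyUpTo⁺ id (≡true⇒T pi) i<n))

count : {A : Set} → (A → Bool) → List A → ℕ
count P xs = length (filterᵇ P xs)

private variable A B : Set

count-∷ : ∀ (P : A → Bool) x xs → count P (x ∷ xs) ≡ 𝟙 (P x) + count P xs
count-∷ P x xs with P x
... | true  = refl
... | false = refl

count-++ : ∀ (P : A → Bool) xs ys → count P (xs ++ ys) ≡ count P xs + count P ys
count-++ P []       ys = refl
count-++ P (x ∷ xs) ys rewrite count-∷ P x (xs ++ ys) | count-∷ P x xs | count-++ P xs ys =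
  sym (+-assoc (𝟙 (P x)) _ _)

count-cong : ∀ {P Q : A → Bool} {xs} → All (λ x → P x ≡ Q x) xs → count P xs ≡ count Q xs
count-cong {xs = []}     []       = refl
count-cong {P = P} {Q} {x ∷ xs} (e ∷ es) rewrite count-∷ P x xs | count-∷ Q x xs | e | count-cong es = refl

count-filterᵇ : ∀ (P Q : A → Bool) xs → count Q (filterᵇ P xs) ≡ count (λ x → P x ∧ Q x) xs
count-filterᵇ P Q [] = refl
count-filterᵇ P Q (x ∷ xs) rewrite count-∷ (λ y → P y ∧ Q y) x xs with P x
... | true  rewrite count-∷ Q x (filterᵇ P xs) | count-filterᵇ P Q xs = refl
... | false = count-filterᵇ P Q xs

count-false : ∀ (P : A → Bool) xs → (∀ x → P x ≡ false) → count P xs ≡ 0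
count-false P []       h = refl
count-false P (x ∷ xs) h rewrite count-∷ P x xs | h x = count-false P xs h

count-∧ʳ : ∀ (P : A → Bool) b xs → count (λ x → P x ∧ b) xs ≡ count P xs * 𝟙 b
count-∧ʳ P b [] = refl
count-∧ʳ P b (x ∷ xs) rewrite count-∷ (λ x → P x ∧ b) x xs | count-∷ P x xs | count-∧ʳ P b xs | 𝟙-∧ (P x) b =
  sym (*-distribʳ-+ (𝟙 b) (𝟙 (P x)) (count P xs))

count-∧ˡ : ∀ b (Q : A → Bool) xs → count (λ x → b ∧ Q x) xs ≡ (if b then count Q xs else 0)
count-∧ˡ true  Q xs = refl
count-∧ˡ false Q xs = count-false _ xs (λ _ → refl)

count≡sum : ∀ (P : A → Bool) xs → count P xs ≡ sum (map (𝟙 ∘ P) xs)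
count≡sum P []       = refl
count≡sum P (x ∷ xs) rewrite count-∷ P x xs | count≡sum P xs = refl

sum-map-cong : ∀ {f g : A → ℕ} xs → (∀ x → f x ≡ g x) → sum (map f xs) ≡ sum (map g xs)
sum-map-cong []       h = refl
sum-map-cong (x ∷ xs) h = cong₂ _+_ (h x) (sum-map-cong xs h)

sum-map-congᴬ : ∀ {f g : A → ℕ} {xs} → All (λ x → f x ≡ g x) xs → sum (map f xs) ≡ sum (map g xs)
sum-map-congᴬ []       = refl
sum-map-congᴬ (e ∷ es) = cong₂ _+_ e (sum-map-congᴬ es)

sum-map-zero : ∀ xs → sum (map (λ (_ : A) → 0) xs) ≡ 0
sum-map-zero []       = refl
sum-map-zero (x ∷ xs) = sum-map-zero xs

sum-map-+ : ∀ (f g : A → ℕ) xs → sum (map (λ x → f x + g x) xs) ≡ sum (map f xs) + sum (map g xs)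
sum-map-+ f g []       = refl
sum-map-+ f g (x ∷ xs) rewrite sum-map-+ f g xs = interchange (f x) (g x) (sum (map f xs)) (sum (map g xs))

sum-map-*ˡ : ∀ a (f : A → ℕ) xs → sum (map (λ x → a * f x) xs) ≡ a * sum (map f xs)
sum-map-*ˡ a f []       = sym (*-zeroʳ a)
sum-map-*ˡ a f (x ∷ xs) rewrite sum-map-*ˡ a f xs = sym (*-distribˡ-+ a (f x) _)

count-concatMap : ∀ (P : B → Bool) (f : A → List B) xs →
  count P (concatMap f xs) ≡ sum (map (λ x → count P (f x)) xs)
count-concatMap P f []       = refl
count-concatMap P f (x ∷ xs) rewrite count-++ P (f x) (concatMap f xs) | count-concatMap P f xs = refl

count-map : ∀ (P : B → Bool) (f : A → B) xs → count P (map f xs) ≡ count (P ∘ f) xs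
count-map P f []       = refl
count-map P f (x ∷ xs) rewrite count-∷ P (f x) (map f xs) | count-∷ (P ∘ f) x xs | count-map P f xs = refl

sum-map-comm : ∀ (h : A → B → ℕ) xs ys →
  sum (map (λ x → sum (map (h x) ys)) xs) ≡ sum (map (λ y → sum (map (λ x → h x y) xs)) ys)
sum-map-comm h []       ys = sym (sum-map-zero ys)
sum-map-comm h (x ∷ xs) ys rewrite sum-map-comm h xs ys =
  sym (sum-map-+ (h x) (λ y → sum (map (λ x → h x y) xs)) ys)

count-fibres : ∀ (P : A → Bool) (f : A → B) (eq : B → B → Bool) xs ys →
  All (λ x → P x ≡ true → count (eq (f x)) ys ≡ 1) xs →
  count P xs ≡ sum (map (λ y → count (λ x → P x ∧ eq (f x) y) xs) ys)
count-fibres P f eq []       ys []       = sym (sum-map-zero ys)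
count-fibres P f eq (x ∷ xs) ys (h ∷ hs) = begin
  count P (x ∷ xs)                                                ≡⟨ count-∷ P x xs ⟩
  𝟙 (P x) + count P xs                                            ≡⟨ cong₂ _+_ head (count-fibres P f eq xs ys hs) ⟩
  sum (map (λ y → 𝟙 (P x ∧ eq (f x) y)) ys) + sum (map (λ y → count (λ x → P x ∧ eq (f x) y) xs) ys)
                                                                  ≡⟨ sym (sum-map-+ _ _ ys) ⟩
  sum (map (λ y → 𝟙 (P x ∧ eq (f x) y) + count (λ x → P x ∧ eq (f x) y) xs) ys)
                                                                  ≡⟨ sum-map-cong ys (λ y → sym (count-∷ _ x xs)) ⟩
  sum (map (λ y → count (λ x → P x ∧ eq (f x) y) (x ∷ xs)) ys)    ∎
  where
  open ≡-Reasoning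
  head : 𝟙 (P x) ≡ sum (map (λ y → 𝟙 (P x ∧ eq (f x) y)) ys)
  head with P x
  ... | true  = trans (sym (h refl)) (count≡sum (eq (f x)) ys)
  ... | false = sym (sum-map-zero ys)

∑ : ℕ → (ℕ → ℕ) → ℕ
∑ zero    g = 0
∑ (suc n) g = ∑ n g + g n

sum-map-upTo : ∀ n (g : ℕ → ℕ) → sum (map g (upTo n)) ≡ ∑ n g
sum-map-upTo zero    g = refl
sum-map-upTo (suc n) g = begin
  sum (map g (upTo (suc n)))      ≡⟨ cong (sum ∘ map g) (sym (Listₚ.upTo-∷ʳ n)) ⟩
  sum (map g (upTo n ++ n ∷ []))  ≡⟨ cong sum (Listₚ.map-++ g (upTo n) (n ∷ [])) ⟩
  sum (map g (upTo n) ++ g n ∷ []) ≡⟨ sum-++ (map g (upTo n)) (g n ∷ []) ⟩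
  sum (map g (upTo n)) + (g n + 0) ≡⟨ cong₂ _+_ (sum-map-upTo n g) (+-identityʳ (g n)) ⟩
  ∑ n g + g n                      ∎
  where open ≡-Reasoning

∑-suc : ∀ n (g : ℕ → ℕ) → ∑ (suc n) g ≡ g 0 + ∑ n (g ∘ suc)
∑-suc zero    g = +-comm 0 (g 0)
∑-suc (suc n) g rewrite ∑-suc n g = +-assoc (g 0) _ _

∑-cong : ∀ n {f g : ℕ → ℕ} → (∀ i → i < n → f i ≡ g i) → ∑ n f ≡ ∑ n g
∑-cong zero    h = refl
∑-cong (suc n) h = cong₂ _+_ (∑-cong n (λ i i<n → h i (m<n⇒m<1+n i<n))) (h n ≤-refl)

∑-zero : ∀ n → ∑ n (λ _ → 0) ≡ 0
∑-zero zero    = refl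
∑-zero (suc n) rewrite ∑-zero n = refl

∑-+ : ∀ n (f g : ℕ → ℕ) → ∑ n (λ i → f i + g i) ≡ ∑ n f + ∑ n g
∑-+ zero    f g = refl
∑-+ (suc n) f g rewrite ∑-+ n f g = interchange (∑ n f) (∑ n g) (f n) (g n)

∑-*ˡ : ∀ n a (f : ℕ → ℕ) → ∑ n (λ i → a * f i) ≡ a * ∑ n f
∑-*ˡ zero    a f = sym (*-zeroʳ a)
∑-*ˡ (suc n) a f rewrite ∑-*ˡ n a f = sym (*-distribˡ-+ a (∑ n f) (f n))

∑-indicator : ∀ n v (g : ℕ → ℕ) → ∑ n (λ x → 𝟙 (v ≡ᵇ x) * g x) ≡ (if v <ᵇ n then g v else 0)
∑-indicator zero    v g = refl
∑-indicator (suc n) v g with <-cmp v n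
... | tri< v<n _ _ rewrite ∑-indicator n v g | <ᵇ-true v<n | <ᵇ-true (m<n⇒m<1+n v<n) | ≡ᵇ-false (<⇒≢ v<n) =
  +-identityʳ (g v)
... | tri≈ _ refl _ rewrite ∑-indicator n v g | <ᵇ-false (n≮n v) | <ᵇ-true (n<1+n v) | ≡ᵇ-refl v =
  +-identityʳ (g v)
... | tri> _ _ n<v rewrite ∑-indicator n v g | <ᵇ-false (<⇒≯ n<v) | <ᵇ-false {v} {suc n} (<⇒≱ n<v ∘ s≤s⁻¹) | ≡ᵇ-false (>⇒≢ n<v) =
  refl

∑-reflect : ∀ D s (g : ℕ → ℕ) → s ≤ D → ∑ D (λ x → if suc x ≤ᵇ s then g (s ∸ suc x) else 0) ≡ ∑ s g
∑-reflect D       zero    g _  = ∑-zero D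
∑-reflect (suc D) (suc s) g le = begin
  ∑ (suc D) (λ x → if suc x ≤ᵇ suc s then g (suc s ∸ suc x) else 0)          ≡⟨ ∑-suc D _ ⟩
  g s + ∑ D (λ x → if suc (suc x) ≤ᵇ suc s then g (s ∸ suc x) else 0)
    ≡⟨ cong (g s +_) (∑-cong D (λ x _ → cong (λ b → if b then g (s ∸ suc x) else 0) (≤ᵇ-suc (suc x) s))) ⟩
  g s + ∑ D (λ x → if suc x ≤ᵇ s then g (s ∸ suc x) else 0)                   ≡⟨ cong (g s +_) (∑-reflect D s g (s≤s⁻¹ le)) ⟩
  g s + ∑ s g                                                                  ≡⟨ +-comm (g s) (∑ s g) ⟩
  ∑ (suc s) g                                                                  ∎
  where open ≡-Reasoning

∑-C-hockeyStick : ∀ s j → ∑ s (_C j) ≡ s C suc j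
∑-C-hockeyStick zero    j = refl
∑-C-hockeyStick (suc s) j rewrite ∑-C-hockeyStick s j =
  trans (+-comm (s C suc j) (s C j)) (nCk+nC[k+1]≡[n+1]C[k+1] s j)

sum-map-groupBy : ∀ {A : Set} (L : A → ℕ) (g : ℕ → ℕ) J xs →
  sum (map (λ x → if L x ≤ᵇ J then g (L x) else 0) xs) ≡ ∑ (suc J) (λ m → g m * count (λ x → L x ≡ᵇ m) xs)
sum-map-groupBy L g J []       = sym (trans (∑-cong (suc J) (λ m _ → *-zeroʳ (g m))) (∑-zero (suc J)))
sum-map-groupBy L g J (x ∷ xs) = sym (begin
  ∑ (suc J) (λ m → g m * count (λ x → L x ≡ᵇ m) (x ∷ xs))
    ≡⟨ ∑-cong (suc J) (λ m _ → trans (cong (g m *_) (count-∷ (λ x → L x ≡ᵇ m) x xs)) (*-distribˡ-+ (g m) _ _)) ⟩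
  ∑ (suc J) (λ m → g m * 𝟙 (L x ≡ᵇ m) + g m * count (λ x → L x ≡ᵇ m) xs)
    ≡⟨ ∑-+ (suc J) _ _ ⟩
  ∑ (suc J) (λ m → g m * 𝟙 (L x ≡ᵇ m)) + ∑ (suc J) (λ m → g m * count (λ x → L x ≡ᵇ m) xs)
    ≡⟨ cong₂ _+_ (trans (∑-cong (suc J) (λ m _ → *-comm (g m) _)) (∑-indicator (suc J) (L x) g)) (sym (sum-map-groupBy L g J xs)) ⟩
  (if L x <ᵇ suc J then g (L x) else 0) + sum (map (λ x → if L x ≤ᵇ J then g (L x) else 0) xs)
    ≡⟨ cong (λ b → (if b then g (L x) else 0) + _) (<ᵇ-suc (L x) J) ⟩
  (if L x ≤ᵇ J then g (L x) else 0) + sum (map (λ x → if L x ≤ᵇ J then g (L x) else 0) xs) ∎)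
  where open ≡-Reasoning

eqList : List ℕ → List ℕ → Bool
eqList []       []       = true
eqList []       (_ ∷ _)  = false
eqList (_ ∷ _)  []       = false
eqList (x ∷ xs) (y ∷ ys) = (x ≡ᵇ y) ∧ eqList xs ys

eqList-refl : ∀ u → eqList u u ≡ true
eqList-refl []      = refl
eqList-refl (x ∷ u) rewrite ≡ᵇ-refl x = eqList-refl u

eqList-sound : ∀ u v → eqList u v ≡ true → u ≡ v
eqList-sound []      []      _ = refl
eqList-sound (x ∷ u) (y ∷ v) e = cong₂ _∷_ (≡ᵇ-sound (proj₁ (∧-split e))) (eqList-sound u v (proj₂ (∧-split {x ≡ᵇ y} e)))

IsWord : ℕ → ℕ → List ℕ → Set
IsWord L m v = length v ≡ L × All (_< m) v

isWord? : ℕ → ℕ → List ℕ → Bool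
isWord? L m v = (length v ≡ᵇ L) ∧ all (_<ᵇ m) v

isWord?-sound : ∀ L m v → isWord? L m v ≡ true → IsWord L m v
isWord?-sound L m v h with ∧-split {length v ≡ᵇ L} h
... | l , a = ≡ᵇ-sound l , All.map (λ {x} → <ᵇ⇒< x m) (Allₚ.all⁺ _ v (≡true⇒T a))

isWord?-complete : ∀ L m v → IsWord L m v → isWord? L m v ≡ true
isWord?-complete L m v (l , a) = ∧-intro (≡ᵇ-true l) (T⇒≡true (Allₚ.all⁻ _ (All.map <⇒<ᵇ a)))

words-isWord : ∀ L m → All (IsWord L m) (words L m)
words-isWord zero    m = (refl , []) ∷ []
words-isWord (suc L) m = go (words L m) (words-isWord L m)
  where
  go : ∀ ws → All (IsWord L m) ws → All (IsWord (suc L) m) (concatMap (λ w → map (_∷ w) (upTo m)) ws)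
  go []       []                = []
  go (w ∷ ws) ((lw , aw) ∷ hs) =
    Allₚ.++⁺ (Allₚ.map⁺ (Allₚ.applyUpTo⁺₁ _ m (λ i<m → cong suc lw , i<m ∷ aw))) (go ws hs)

count-≡ᵇ-upTo : ∀ m y → y < m → count (y ≡ᵇ_) (upTo m) ≡ 1
count-≡ᵇ-upTo m y y<m = begin
  count (y ≡ᵇ_) (upTo m)                   ≡⟨ count≡sum _ (upTo m) ⟩
  sum (map (λ x → 𝟙 (y ≡ᵇ x)) (upTo m))    ≡⟨ sum-map-upTo m _ ⟩
  ∑ m (λ x → 𝟙 (y ≡ᵇ x))                   ≡⟨ ∑-cong m (λ i _ → sym (*-identityʳ (𝟙 (y ≡ᵇ i)))) ⟩
  ∑ m (λ x → 𝟙 (y ≡ᵇ x) * 1)               ≡⟨ ∑-indicator m y (λ _ → 1) ⟩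
  (if y <ᵇ m then 1 else 0)                ≡⟨ cong (if_then 1 else 0) (<ᵇ-true y<m) ⟩
  1                                        ∎
  where open ≡-Reasoning

count-eqList-words : ∀ L m v → IsWord L m v → count (eqList v) (words L m) ≡ 1
count-eqList-words zero    m []      (refl , []) = refl
count-eqList-words (suc L) m (y ∷ v) (lv , (y<m ∷ av)) = begin
  count (eqList (y ∷ v)) (concatMap (λ w → map (_∷ w) (upTo m)) (words L m))
    ≡⟨ count-concatMap (eqList (y ∷ v)) _ (words L m) ⟩
  sum (map (λ w → count (eqList (y ∷ v)) (map (_∷ w) (upTo m))) (words L m))
    ≡⟨ sum-map-cong (words L m) column ⟩
  sum (map (𝟙 ∘ eqList v) (words L m))
    ≡⟨ sym (count≡sum (eqList v) (words L m)) ⟩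
  count (eqList v) (words L m)
    ≡⟨ count-eqList-words L m v (suc-injective lv , av) ⟩
  1 ∎
  where
  open ≡-Reasoning
  column : ∀ w → count (eqList (y ∷ v)) (map (_∷ w) (upTo m)) ≡ 𝟙 (eqList v w)
  column w = begin
    count (eqList (y ∷ v)) (map (_∷ w) (upTo m))      ≡⟨ count-map (eqList (y ∷ v)) (_∷ w) (upTo m) ⟩
    count (λ x → (y ≡ᵇ x) ∧ eqList v w) (upTo m)      ≡⟨ count-∧ʳ (y ≡ᵇ_) (eqList v w) (upTo m) ⟩
    count (y ≡ᵇ_) (upTo m) * 𝟙 (eqList v w)           ≡⟨ cong (_* 𝟙 (eqList v w)) (count-≡ᵇ-upTo m y y<m) ⟩
    1 * 𝟙 (eqList v w)                                ≡⟨ *-identityˡ _ ⟩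
    𝟙 (eqList v w)                                    ∎

count-eqList-filterᵇ-words : ∀ (P : List ℕ → Bool) L m v → P v ≡ true → IsWord L m v →
  count (eqList v) (filterᵇ P (words L m)) ≡ 1
count-eqList-filterᵇ-words P L m v pv wv = begin
  count (eqList v) (filterᵇ P (words L m))     ≡⟨ count-filterᵇ P (eqList v) (words L m) ⟩
  count (λ x → P x ∧ eqList v x) (words L m)   ≡⟨ count-cong {xs = words L m} (All.tabulate (λ {x} _ → guard x)) ⟩
  count (eqList v) (words L m)                 ≡⟨ count-eqList-words L m v wv ⟩
  1                                            ∎
  where
  open ≡-Reasoning
  guard : ∀ x → P x ∧ eqList v x ≡ eqList v x
  guard x with eqList v x in e
  ... | true  rewrite sym (eqList-sound v x e) = cong (_∧ true) pv
  ... | false = Boolₚ.∧-zeroʳ (P x)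

-- Inserting and removing a block

punchIn : ℕ → ℕ → ℕ
punchIn b x = if x <ᵇ b then x else suc x

punchOut : ℕ → ℕ → ℕ
punchOut b x = if x <ᵇ b then x else x ∸ 1

module _ {b x : ℕ} where

  punchIn-< : x < b → punchIn b x ≡ x
  punchIn-< x<b rewrite <ᵇ-true x<b = refl

  punchIn-≥ : b ≤ x → punchIn b x ≡ suc x
  punchIn-≥ b≤x rewrite <ᵇ-false {x} {b} (≤⇒≯ b≤x) = refl

  punchOut-< : x < b → punchOut b x ≡ x
  punchOut-< x<b rewrite <ᵇ-true x<b = refl

  punchOut-≥ : b ≤ x → punchOut b x ≡ x ∸ 1
  punchOut-≥ b≤x rewrite <ᵇ-false {x} {b} (≤⇒≯ b≤x) = refl

punchIn≢ : ∀ b x → punchIn b x ≢ b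
punchIn≢ b x with <-cmp x b
... | tri< x<b _ _ rewrite punchIn-< x<b = <⇒≢ x<b
... | tri≈ _ refl _ rewrite punchIn-≥ {b} {b} ≤-refl = (<⇒≢ (n<1+n b)) ∘ sym
... | tri> _ _ b<x rewrite punchIn-≥ {b} {x} (<⇒≤ b<x) = (<⇒≢ (m<n⇒m<1+n b<x)) ∘ sym

punchIn-punchOut : ∀ b x → x ≢ b → punchIn b (punchOut b x) ≡ x
punchIn-punchOut b x x≢b with <-cmp x b
... | tri< x<b _ _ rewrite punchOut-< x<b | punchIn-< x<b = refl
... | tri≈ _ x≡b _ = ⊥-elim (x≢b x≡b)
punchIn-punchOut b (suc x) _ | tri> _ _ b<x
  rewrite punchOut-≥ {b} {suc x} (<⇒≤ b<x) | punchIn-≥ {b} {x} (s≤s⁻¹ b<x) = refl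

punchOut-punchIn : ∀ b x → punchOut b (punchIn b x) ≡ x
punchOut-punchIn b x with <-cmp x b
... | tri< x<b _ _ rewrite punchIn-< x<b | punchOut-< x<b = refl
... | tri≈ _ refl _ rewrite punchIn-≥ {b} {b} ≤-refl | punchOut-≥ {b} {suc b} (n≤1+n b) = refl
... | tri> _ _ b<x rewrite punchIn-≥ {b} {x} (<⇒≤ b<x) | punchOut-≥ {b} {suc x} (m≤n⇒m≤1+n (<⇒≤ b<x)) = refl

punchIn-injective : ∀ b x y → punchIn b x ≡ punchIn b y → x ≡ y
punchIn-injective b x y e = trans (sym (punchOut-punchIn b x)) (trans (cong (punchOut b) e) (punchOut-punchIn b y))

punchIn-≡ᵇ : ∀ b x y → (punchIn b x ≡ᵇ punchIn b y) ≡ (x ≡ᵇ y)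
punchIn-≡ᵇ b x y with x ≡ᵇ y in e
... | true  = ≡ᵇ-true (cong (punchIn b) (≡ᵇ-sound e))
... | false = ≡ᵇ-false (≡ᵇ-false⇒≢ e ∘ punchIn-injective b x y)

punchIn≤suc : ∀ b x → punchIn b x ≤ suc x
punchIn≤suc b x with x <ᵇ b
... | true  = n≤1+n x
... | false = ≤-refl

punchOut-bound : ∀ {N b y} → y < suc N → b < suc N → y ≢ b → punchOut b y < N
punchOut-bound {N} {b} {y} y<1+N b<1+N y≢b with <-cmp y b
... | tri< y<b _ _ rewrite punchOut-< y<b = <-≤-trans y<b (s≤s⁻¹ b<1+N)
... | tri≈ _ y≡b _ = ⊥-elim (y≢b y≡b)
... | tri> _ _ b<y rewrite punchOut-≥ {b} {y} (<⇒≤ b<y) = ∸-monoˡ-< y<1+N (≤-trans (s≤s z≤n) b<y)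

-- Inserting a new block b into a word w: the i-th entry of cs is the number of new letters placed
-- in the i-th of the length w + 1 gaps of w, and the old labels ≥ b move up by one.
insertBlock : ℕ → List ℕ → List ℕ → List ℕ
insertBlock b []       w       = []
insertBlock b (c ∷ cs) []      = replicate c b
insertBlock b (c ∷ cs) (x ∷ w) = replicate c b ++ punchIn b x ∷ insertBlock b cs w

removeBlock : ℕ → List ℕ → List ℕ
removeBlock e []      = []
removeBlock e (x ∷ w) = if e ≡ᵇ x then removeBlock e w else punchOut e x ∷ removeBlock e w

sucHead : List ℕ → List ℕ
sucHead []      = []
sucHead (h ∷ t) = suc h ∷ t

gaps : ℕ → List ℕ → List ℕ
gaps e []      = 0 ∷ []
gaps e (x ∷ w) = if e ≡ᵇ x then sucHead (gaps e w) else 0 ∷ gaps e w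

gaps-∷ : ∀ e w → ∃ λ h → ∃ λ t → gaps e w ≡ h ∷ t
gaps-∷ e []      = 0 , [] , refl
gaps-∷ e (x ∷ w) with e ≡ᵇ x | gaps-∷ e w
... | false | _           = 0 , gaps e w , refl
... | true  | h , t , eq rewrite eq = suc h , t , refl

insertBlock-suc : ∀ b c cs w → insertBlock b (suc c ∷ cs) w ≡ b ∷ insertBlock b (c ∷ cs) w
insertBlock-suc b c cs []      = refl
insertBlock-suc b c cs (x ∷ w) = refl

insertBlock-gaps-removeBlock : ∀ e w → insertBlock e (gaps e w) (removeBlock e w) ≡ w
insertBlock-gaps-removeBlock e []      = refl
insertBlock-gaps-removeBlock e (x ∷ w) with e ≡ᵇ x in e≡ᵇx
... | true with h , t , eq ← gaps-∷ e w = begin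
  insertBlock e (sucHead (gaps e w)) (removeBlock e w)  ≡⟨ cong (λ p → insertBlock e (sucHead p) (removeBlock e w)) eq ⟩
  insertBlock e (suc h ∷ t) (removeBlock e w)          ≡⟨ insertBlock-suc e h t (removeBlock e w) ⟩
  e ∷ insertBlock e (h ∷ t) (removeBlock e w)          ≡⟨ cong₂ _∷_ (≡ᵇ-sound e≡ᵇx) (subst (λ p → insertBlock e p (removeBlock e w) ≡ w)
                                                              eq (insertBlock-gaps-removeBlock e w)) ⟩
  x ∷ w                                                 ∎
  where open ≡-Reasoning
... | false = cong₂ _∷_ (punchIn-punchOut e x (≡ᵇ-false⇒≢ e≡ᵇx ∘ sym)) (insertBlock-gaps-removeBlock e w)

removeBlock-replicate : ∀ b c v → removeBlock b (replicate c b ++ v) ≡ removeBlock b v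
removeBlock-replicate b zero    v = refl
removeBlock-replicate b (suc c) v rewrite ≡ᵇ-refl b = removeBlock-replicate b c v

removeBlock-insertBlock : ∀ b cs w → length cs ≡ suc (length w) → removeBlock b (insertBlock b cs w) ≡ w
removeBlock-insertBlock b (c ∷ []) [] _ =
  trans (cong (removeBlock b) (sym (Listₚ.++-identityʳ (replicate c b)))) (removeBlock-replicate b c [])
removeBlock-insertBlock b (c ∷ cs) (x ∷ w) l
  rewrite removeBlock-replicate b c (punchIn b x ∷ insertBlock b cs w) | ≡ᵇ-false (punchIn≢ b x ∘ sym) =
  cong₂ _∷_ (punchOut-punchIn b x) (removeBlock-insertBlock b cs w (suc-injective l))

gaps-replicate : ∀ b c y v → y ≢ b → gaps b (replicate c b ++ y ∷ v) ≡ c ∷ gaps b v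
gaps-replicate b zero    y v y≢b rewrite ≡ᵇ-false (y≢b ∘ sym) = refl
gaps-replicate b (suc c) y v y≢b rewrite ≡ᵇ-refl b | gaps-replicate b c y v y≢b = refl

gaps-replicate-end : ∀ b c → gaps b (replicate c b) ≡ c ∷ []
gaps-replicate-end b zero    = refl
gaps-replicate-end b (suc c) rewrite ≡ᵇ-refl b | gaps-replicate-end b c = refl

gaps-insertBlock : ∀ b cs w → length cs ≡ suc (length w) → gaps b (insertBlock b cs w) ≡ cs
gaps-insertBlock b (c ∷ [])  []      _ = gaps-replicate-end b c
gaps-insertBlock b (c ∷ cs) (x ∷ w) l rewrite gaps-replicate b c (punchIn b x) (insertBlock b cs w) (punchIn≢ b x) =
  cong (c ∷_) (gaps-insertBlock b cs w (suc-injective l))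

gaps-replicate-other : ∀ e b c v → b ≢ e → gaps e (replicate c b ++ v) ≡ replicate c 0 ++ gaps e v
gaps-replicate-other e b zero    v b≢e = refl
gaps-replicate-other e b (suc c) v b≢e rewrite ≡ᵇ-false (b≢e ∘ sym) = cong (0 ∷_) (gaps-replicate-other e b c v b≢e)

-- The gaps of any other block e see the letters b as separators, so they can only
-- reproduce cs when no letter b was inserted at all.
gaps-insertBlock-other : ∀ e b cs w → b ≢ e → length cs ≡ suc (length w) →
  gaps e (insertBlock b cs w) ≡ cs → sum cs ≡ 0
gaps-insertBlock-other e b (zero ∷ [])  [] _ _ _ = refl
gaps-insertBlock-other e b (suc c ∷ []) [] b≢e _ eq
  with () ← trans (sym (gaps-replicate-other e b (suc c) [] b≢e))
                  (trans (cong (gaps e) (Listₚ.++-identityʳ (replicate (suc c) b))) eq)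
gaps-insertBlock-other e b (suc c ∷ cs) (x ∷ w) b≢e _ eq
  rewrite gaps-replicate-other e b (suc c) (punchIn b x ∷ insertBlock b cs w) b≢e with () ← eq
gaps-insertBlock-other e b (zero ∷ cs) (x ∷ w) b≢e l eq with e ≡ᵇ punchIn b x | gaps-∷ e (insertBlock b cs w)
... | true  | h , t , p rewrite p with () ← eq
... | false | _ = gaps-insertBlock-other e b cs w b≢e (suc-injective l) (Listₚ.∷-injectiveʳ eq)

length-insertBlock : ∀ b cs w → length cs ≡ suc (length w) → length (insertBlock b cs w) ≡ length w + sum cs
length-insertBlock b (c ∷ [])  []      _ = trans (Listₚ.length-replicate c) (sym (+-identityʳ c))
length-insertBlock b (c ∷ cs) (x ∷ w) l = begin
  length (replicate c b ++ punchIn b x ∷ insertBlock b cs w)  ≡⟨ Listₚ.length-++ (replicate c b) ⟩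
  length (replicate c b) + suc (length (insertBlock b cs w))  ≡⟨ cong₂ (λ a z → a + suc z) (Listₚ.length-replicate c)
                                                                     (length-insertBlock b cs w (suc-injective l)) ⟩
  c + suc (length w + sum cs)                                 ≡⟨ +-suc c _ ⟩
  suc (c + (length w + sum cs))                               ≡⟨ cong suc (x+[y+z]≡y+[x+z] c (length w) (sum cs)) ⟩
  suc (length w) + (c + sum cs)                               ∎
  where
  open ≡-Reasoning
  x+[y+z]≡y+[x+z] : ∀ x y z → x + (y + z) ≡ y + (x + z)
  x+[y+z]≡y+[x+z] x y z = trans (sym (+-assoc x y z)) (trans (cong (_+ z) (+-comm x y)) (+-assoc y x z))

length-removeBlock : ∀ e w → length (removeBlock e w) + occ e w ≡ length w
length-removeBlock e []      = refl
length-removeBlock e (x ∷ w) with e ≡ᵇ x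
... | true  = trans (+-suc _ _) (cong suc (length-removeBlock e w))
... | false = cong suc (length-removeBlock e w)

length-gaps : ∀ e w → length (gaps e w) ≡ suc (length (removeBlock e w))
length-gaps e []      = refl
length-gaps e (x ∷ w) with e ≡ᵇ x | gaps-∷ e w
... | true  | h , t , eq rewrite eq = trans (sym (cong length eq)) (length-gaps e w)
... | false | _                     = cong suc (length-gaps e w)

gaps-≤-occ : ∀ e w → All (_≤ occ e w) (gaps e w)
gaps-≤-occ e []      = z≤n ∷ []
gaps-≤-occ e (x ∷ w) with e ≡ᵇ x | gaps-∷ e w | gaps-≤-occ e w
... | true  | h , t , eq | ih rewrite eq with h≤ ∷ t≤ ← ih = s≤s h≤ ∷ All.map m≤n⇒m≤1+n t≤
... | false | _          | ih = z≤n ∷ ih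

removeBlock-< : ∀ N e w → e < suc N → All (_< suc N) w → All (_< N) (removeBlock e w)
removeBlock-< N e []      _     []           = []
removeBlock-< N e (x ∷ w) e<1+N (x<1+N ∷ a) with e ≡ᵇ x in e≡ᵇx
... | true  = removeBlock-< N e w e<1+N a
... | false = punchOut-bound x<1+N e<1+N (≡ᵇ-false⇒≢ e≡ᵇx ∘ sym) ∷ removeBlock-< N e w e<1+N a

insertBlock-< : ∀ N b cs w → All (_< N) w → b < suc N → All (_< suc N) (insertBlock b cs w)
insertBlock-< N b []       w       _           _     = []
insertBlock-< N b (c ∷ cs) []      _           b<1+N = Allₚ.replicate⁺ c b<1+N
insertBlock-< N b (c ∷ cs) (x ∷ w) (x<N ∷ a) b<1+N =
  Allₚ.++⁺ (Allₚ.replicate⁺ c b<1+N) (≤-<-trans (punchIn≤suc b x) (s≤s x<N) ∷ insertBlock-< N b cs w a b<1+N)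

occ-∷ : ∀ y x w → occ y (x ∷ w) ≡ 𝟙 (y ≡ᵇ x) + occ y w
occ-∷ y x w with y ≡ᵇ x
... | true  = refl
... | false = refl

occ-replicate-++ : ∀ y b c v → occ y (replicate c b ++ v) ≡ 𝟙 (y ≡ᵇ b) * c + occ y v
occ-replicate-++ y b zero    v rewrite *-zeroʳ (𝟙 (y ≡ᵇ b)) = refl
occ-replicate-++ y b (suc c) v rewrite occ-∷ y b (replicate c b ++ v) | occ-replicate-++ y b c v | *-suc (𝟙 (y ≡ᵇ b)) c =
  sym (+-assoc (𝟙 (y ≡ᵇ b)) _ _)

occ-insertBlock-new : ∀ b cs w → length cs ≡ suc (length w) → occ b (insertBlock b cs w) ≡ sum cs
occ-insertBlock-new b (c ∷ []) [] _ rewrite sym (Listₚ.++-identityʳ (replicate c b)) | occ-replicate-++ b b c [] | ≡ᵇ-refl b =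
  trans (+-identityʳ _) (trans (*-identityˡ c) (sym (+-identityʳ c)))
occ-insertBlock-new b (c ∷ cs) (x ∷ w) l
  rewrite occ-replicate-++ b b c (punchIn b x ∷ insertBlock b cs w) | ≡ᵇ-refl b | occ-∷ b (punchIn b x) (insertBlock b cs w)
        | ≡ᵇ-false (punchIn≢ b x ∘ sym) | occ-insertBlock-new b cs w (suc-injective l) | +-identityʳ c = refl

occ-insertBlock-old : ∀ y b cs w → y ≢ b → length cs ≡ suc (length w) →
  occ y (insertBlock b cs w) ≡ occ (punchOut b y) w
occ-insertBlock-old y b (c ∷ []) [] y≢b _ rewrite sym (Listₚ.++-identityʳ (replicate c b)) | occ-replicate-++ y b c [] | ≡ᵇ-false y≢b =
  refl
occ-insertBlock-old y b (c ∷ cs) (x ∷ w) y≢b l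
  rewrite occ-replicate-++ y b c (punchIn b x ∷ insertBlock b cs w) | ≡ᵇ-false y≢b | occ-∷ y (punchIn b x) (insertBlock b cs w)
        | occ-∷ (punchOut b y) x w | occ-insertBlock-old y b cs w y≢b (suc-injective l) =
  cong (λ t → 𝟙 t + occ (punchOut b y) w) (≡ᵇ-cong-⇔
    (λ e → trans (cong (punchOut b) e) (punchOut-punchIn b x))
    (λ e → trans (sym (punchIn-punchOut b y y≢b)) (cong (punchIn b) e)))

occ-removeBlock : ∀ e y w → occ y (removeBlock e w) ≡ occ (punchIn e y) w
occ-removeBlock e y []      = refl
occ-removeBlock e y (x ∷ w) with e ≡ᵇ x in e≡ᵇx
... | true rewrite occ-∷ (punchIn e y) x w | ≡ᵇ-false (λ q → punchIn≢ e y (trans q (sym (≡ᵇ-sound e≡ᵇx)))) =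
  occ-removeBlock e y w
... | false rewrite occ-∷ (punchIn e y) x w | occ-∷ y (punchOut e x) (removeBlock e w) | occ-removeBlock e y w =
  cong (λ t → 𝟙 t + occ (punchIn e y) w) (≡ᵇ-cong-⇔
    (λ q → trans (cong (punchIn e) q) (punchIn-punchOut e x (≡ᵇ-false⇒≢ e≡ᵇx ∘ sym)))
    (λ q → trans (sym (punchOut-punchIn e y)) (cong (punchOut e) q)))

-- Loops after inserting a block

loopBlocksFrom : ℕ → List ℕ → List ℕ
loopBlocksFrom p []      = []
loopBlocksFrom p (y ∷ w) = if p ≡ᵇ y then p ∷ loopBlocksFrom y w else loopBlocksFrom y w

loopBlocks-∷ : ∀ x w → loopBlocks (x ∷ w) ≡ loopBlocksFrom x w
loopBlocks-∷ x []      = refl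
loopBlocks-∷ x (y ∷ w) with x ≡ᵇ y
... | true  = cong (x ∷_) (loopBlocks-∷ y w)
... | false = loopBlocks-∷ y w

loopBlocksFrom-∈ : ∀ p w {h t} → loopBlocksFrom p w ≡ h ∷ t → h ∈ p ∷ w
loopBlocksFrom-∈ p (y ∷ w) eq with p ≡ᵇ y
loopBlocksFrom-∈ p (y ∷ w) refl | true = here refl
... | false = there (loopBlocksFrom-∈ y w eq)

loopBlocks-∈ : ∀ w {h t} → loopBlocks w ≡ h ∷ t → h ∈ w
loopBlocks-∈ (x ∷ w) eq = loopBlocksFrom-∈ x w (trans (sym (loopBlocks-∷ x w)) eq)

loopBlocksFrom-replicate : ∀ b c v → loopBlocksFrom b (replicate c b ++ v) ≡ replicate c b ++ loopBlocksFrom b v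
loopBlocksFrom-replicate b zero    v = refl
loopBlocksFrom-replicate b (suc c) v rewrite ≡ᵇ-refl b = cong (b ∷_) (loopBlocksFrom-replicate b c v)

loopBlocksFrom-replicate-end : ∀ b c → loopBlocksFrom b (replicate c b) ≡ replicate c b
loopBlocksFrom-replicate-end b c = begin
  loopBlocksFrom b (replicate c b)         ≡⟨ cong (loopBlocksFrom b) (sym (Listₚ.++-identityʳ (replicate c b))) ⟩
  loopBlocksFrom b (replicate c b ++ [])   ≡⟨ loopBlocksFrom-replicate b c [] ⟩
  replicate c b ++ []                      ≡⟨ Listₚ.++-identityʳ (replicate c b) ⟩
  replicate c b                            ∎
  where open ≡-Reasoning

loopBlocksFrom-≢ : ∀ p y v → p ≢ y → loopBlocksFrom p (y ∷ v) ≡ loopBlocksFrom y v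
loopBlocksFrom-≢ p y v p≢y rewrite ≡ᵇ-false p≢y = refl

loopBlocksFrom-≢-replicate : ∀ p b c v → p ≢ b →
  loopBlocksFrom p (replicate (suc c) b ++ v) ≡ replicate c b ++ loopBlocksFrom b v
loopBlocksFrom-≢-replicate p b c v p≢b rewrite ≡ᵇ-false p≢b = loopBlocksFrom-replicate b c v

all-replicate-++ : ∀ (p : ℕ → Bool) b n v → p b ≡ true → all p (replicate n b ++ v) ≡ all p v
all-replicate-++ p b zero    v pb = refl
all-replicate-++ p b (suc n) v pb rewrite pb = all-replicate-++ p b n v pb

runLoops : List ℕ → ℕ
runLoops []       = 0
runLoops (c ∷ cs) = (c ∸ 1) + runLoops cs

loopFlagsFrom : ℕ → List ℕ → List Bool
loopFlagsFrom x []      = false ∷ []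
loopFlagsFrom x (y ∷ w) = (x ≡ᵇ y) ∷ loopFlagsFrom y w

-- One flag per gap of w, both ends included: is that gap a loop of w?
loopFlags : List ℕ → List Bool
loopFlags []      = false ∷ []
loopFlags (x ∷ w) = false ∷ loopFlagsFrom x w

flaggedZeros : List Bool → List ℕ → ℕ
flaggedZeros (f ∷ fs) (zero ∷ cs)  = 𝟙 f + flaggedZeros fs cs
flaggedZeros (f ∷ fs) (suc _ ∷ cs) = flaggedZeros fs cs
flaggedZeros _        _            = 0

flaggedZeros-false∷ : ∀ fs c cs → flaggedZeros (false ∷ fs) (c ∷ cs) ≡ flaggedZeros fs cs
flaggedZeros-false∷ fs zero    cs = refl
flaggedZeros-false∷ fs (suc _) cs = refl

length-loopBlocksFrom-insertBlock : ∀ b x cs w → length cs ≡ suc (length w) →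
  length (loopBlocksFrom (punchIn b x) (insertBlock b cs w)) ≡ runLoops cs + flaggedZeros (loopFlagsFrom x w) cs
length-loopBlocksFrom-insertBlock b x (zero ∷ [])  [] _ = refl
length-loopBlocksFrom-insertBlock b x (suc c ∷ []) [] _ rewrite ≡ᵇ-false (punchIn≢ b x) | loopBlocksFrom-replicate-end b c =
  trans (Listₚ.length-replicate c) (sym (trans (+-identityʳ _) (+-identityʳ c)))
length-loopBlocksFrom-insertBlock b x (zero ∷ cs) (y ∷ w) l rewrite punchIn-≡ᵇ b x y with x ≡ᵇ y
... | true  = trans (cong suc (length-loopBlocksFrom-insertBlock b y cs w (suc-injective l))) (sym (+-suc (runLoops cs) _))
... | false = length-loopBlocksFrom-insertBlock b y cs w (suc-injective l)
length-loopBlocksFrom-insertBlock b x (suc c ∷ cs) (y ∷ w) l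
  rewrite loopBlocksFrom-≢-replicate (punchIn b x) b c (punchIn b y ∷ insertBlock b cs w) (punchIn≢ b x)
        | loopBlocksFrom-≢ b (punchIn b y) (insertBlock b cs w) (punchIn≢ b y ∘ sym) =
  trans (Listₚ.length-++ (replicate c b))
    (trans (cong₂ _+_ (Listₚ.length-replicate c) (length-loopBlocksFrom-insertBlock b y cs w (suc-injective l)))
           (sym (+-assoc c _ _)))

all-loopBlocksFrom-insertBlock : ∀ b x cs w → length cs ≡ suc (length w) →
  all (_≡ᵇ b) (loopBlocksFrom (punchIn b x) (insertBlock b cs w)) ≡ (flaggedZeros (loopFlagsFrom x w) cs ≡ᵇ 0)
all-loopBlocksFrom-insertBlock b x (zero ∷ [])  [] _ = refl
all-loopBlocksFrom-insertBlock b x (suc c ∷ []) [] _ rewrite ≡ᵇ-false (punchIn≢ b x) | loopBlocksFrom-replicate-end b c =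
  trans (cong (all (_≡ᵇ b)) (sym (Listₚ.++-identityʳ (replicate c b)))) (all-replicate-++ (_≡ᵇ b) b c [] (≡ᵇ-refl b))
all-loopBlocksFrom-insertBlock b x (zero ∷ cs) (y ∷ w) l rewrite punchIn-≡ᵇ b x y with x ≡ᵇ y
... | true rewrite ≡ᵇ-false (punchIn≢ b x) = refl
... | false = all-loopBlocksFrom-insertBlock b y cs w (suc-injective l)
all-loopBlocksFrom-insertBlock b x (suc c ∷ cs) (y ∷ w) l
  rewrite loopBlocksFrom-≢-replicate (punchIn b x) b c (punchIn b y ∷ insertBlock b cs w) (punchIn≢ b x)
        | loopBlocksFrom-≢ b (punchIn b y) (insertBlock b cs w) (punchIn≢ b y ∘ sym)
        | all-replicate-++ (_≡ᵇ b) b c (loopBlocksFrom (punchIn b y) (insertBlock b cs w)) (≡ᵇ-refl b) =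
  all-loopBlocksFrom-insertBlock b y cs w (suc-injective l)

loopBlocksAfterFirstRun : ℕ → List ℕ → List ℕ → List ℕ
loopBlocksAfterFirstRun b cs []      = []
loopBlocksAfterFirstRun b cs (y ∷ w) = loopBlocksFrom (punchIn b y) (insertBlock b cs w)

loopBlocks-insertBlock : ∀ b c cs w →
  loopBlocks (insertBlock b (c ∷ cs) w) ≡ replicate (c ∸ 1) b ++ loopBlocksAfterFirstRun b cs w
loopBlocks-insertBlock b zero    cs []      = refl
loopBlocks-insertBlock b (suc c) cs []      =
  trans (loopBlocks-∷ b (replicate c b)) (trans (loopBlocksFrom-replicate-end b c) (sym (Listₚ.++-identityʳ (replicate c b))))
loopBlocks-insertBlock b zero    cs (y ∷ w) = loopBlocks-∷ (punchIn b y) (insertBlock b cs w)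
loopBlocks-insertBlock b (suc c) cs (y ∷ w) =
  trans (loopBlocks-∷ b (replicate c b ++ punchIn b y ∷ insertBlock b cs w))
    (trans (loopBlocksFrom-replicate b c (punchIn b y ∷ insertBlock b cs w))
           (cong (replicate c b ++_) (loopBlocksFrom-≢ b (punchIn b y) (insertBlock b cs w) (punchIn≢ b y ∘ sym))))

loops-insertBlock : ∀ b cs w → length cs ≡ suc (length w) →
  loops (insertBlock b cs w) ≡ runLoops cs + flaggedZeros (loopFlags w) cs
loops-insertBlock b (zero ∷ [])  [] _ = refl
loops-insertBlock b (suc c ∷ []) [] _ rewrite loopBlocks-insertBlock b (suc c) [] [] =
  trans (Listₚ.length-++ (replicate c b)) (cong (_+ 0) (trans (Listₚ.length-replicate c) (sym (+-identityʳ c))))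
loops-insertBlock b (c ∷ cs) (y ∷ w) l rewrite loopBlocks-insertBlock b c cs (y ∷ w) | flaggedZeros-false∷ (loopFlagsFrom y w) c cs =
  trans (Listₚ.length-++ (replicate (c ∸ 1) b))
    (trans (cong₂ _+_ (Listₚ.length-replicate (c ∸ 1)) (length-loopBlocksFrom-insertBlock b y cs w (suc-injective l)))
           (sym (+-assoc (c ∸ 1) _ _)))

all-loopBlocks-insertBlock : ∀ b cs w → length cs ≡ suc (length w) →
  all (_≡ᵇ b) (loopBlocks (insertBlock b cs w)) ≡ (flaggedZeros (loopFlags w) cs ≡ᵇ 0)
all-loopBlocks-insertBlock b (zero ∷ [])  [] _ = refl
all-loopBlocks-insertBlock b (suc c ∷ []) [] _ rewrite loopBlocks-insertBlock b (suc c) [] [] =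
  all-replicate-++ (_≡ᵇ b) b c [] (≡ᵇ-refl b)
all-loopBlocks-insertBlock b (c ∷ cs) (y ∷ w) l
  rewrite loopBlocks-insertBlock b c cs (y ∷ w) | flaggedZeros-false∷ (loopFlagsFrom y w) c cs
        | all-replicate-++ (_≡ᵇ b) b (c ∸ 1) (loopBlocksAfterFirstRun b cs (y ∷ w)) (≡ᵇ-refl b) =
  all-loopBlocksFrom-insertBlock b y cs w (suc-injective l)

trues : List Bool → ℕ
trues []       = 0
trues (f ∷ fs) = 𝟙 f + trues fs

trues≤length : ∀ fs → trues fs ≤ length fs
trues≤length []           = z≤n
trues≤length (true ∷ fs)  = s≤s (trues≤length fs)
trues≤length (false ∷ fs) = m≤n⇒m≤1+n (trues≤length fs)

length-loopFlagsFrom : ∀ x w → length (loopFlagsFrom x w) ≡ suc (length w)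
length-loopFlagsFrom x []      = refl
length-loopFlagsFrom x (y ∷ w) = cong suc (length-loopFlagsFrom y w)

length-loopFlags : ∀ w → length (loopFlags w) ≡ suc (length w)
length-loopFlags []      = refl
length-loopFlags (x ∷ w) = cong suc (length-loopFlagsFrom x w)

trues-loopFlagsFrom : ∀ x w → trues (loopFlagsFrom x w) ≡ length (loopBlocksFrom x w)
trues-loopFlagsFrom x []      = refl
trues-loopFlagsFrom x (y ∷ w) with x ≡ᵇ y
... | true  = cong suc (trues-loopFlagsFrom y w)
... | false = trues-loopFlagsFrom y w

trues-loopFlags : ∀ w → trues (loopFlags w) ≡ loops w
trues-loopFlags []      = refl
trues-loopFlags (x ∷ w) = trans (trues-loopFlagsFrom x w) (cong length (sym (loopBlocks-∷ x w)))

-- Restricted growth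

rgsStep : ℕ → ℕ → ℕ
rgsStep u x = if x ≡ᵇ u then suc u else u

-- The label a block inserted with gap sizes cs must get for the result to be restricted
-- growth: the number of labels used before its first letter.
newLabel : ℕ → List ℕ → List ℕ → ℕ
newLabel u []           w       = u
newLabel u (suc _ ∷ cs) w       = u
newLabel u (zero ∷ cs)  []      = u
newLabel u (zero ∷ cs)  (x ∷ w) = newLabel (rgsStep u x) cs w

rgsStep-< : ∀ {u x} → x < u → rgsStep u x ≡ u
rgsStep-< x<u rewrite ≡ᵇ-false (<⇒≢ x<u) = refl

rgsStep-≡ : ∀ u → rgsStep u u ≡ suc u
rgsStep-≡ u rewrite ≡ᵇ-refl u = refl

rgsFrom-∷-< : ∀ {u x} w → x < u → rgsFrom u (x ∷ w) ≡ rgsFrom u w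
rgsFrom-∷-< w x<u rewrite <ᵇ-true x<u = refl

rgsFrom-∷-≡ : ∀ u w → rgsFrom u (u ∷ w) ≡ rgsFrom (suc u) w
rgsFrom-∷-≡ u w rewrite <ᵇ-false (n≮n u) | ≡ᵇ-refl u = refl

rgsFrom-∷⁻ : ∀ u x w → rgsFrom u (x ∷ w) ≡ true → (x < u × rgsFrom u w ≡ true) ⊎ (x ≡ u × rgsFrom (suc u) w ≡ true)
rgsFrom-∷⁻ u x w h with x <ᵇ u in x<ᵇu
... | true = inj₁ (<ᵇ⇒< x u (≡true⇒T x<ᵇu) , h)
... | false with x ≡ᵇ u in x≡ᵇu
... | true = inj₂ (≡ᵇ-sound x≡ᵇu , h)

≤-newLabel : ∀ u cs w → u ≤ newLabel u cs w
≤-newLabel u []           w       = ≤-refl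
≤-newLabel u (suc _ ∷ cs) w       = ≤-refl
≤-newLabel u (zero ∷ cs)  []      = ≤-refl
≤-newLabel u (zero ∷ cs)  (x ∷ w) = ≤-trans (≤-rgsStep x) (≤-newLabel (rgsStep u x) cs w)
  where
  ≤-rgsStep : ∀ x → u ≤ rgsStep u x
  ≤-rgsStep x with x ≡ᵇ u
  ... | true  = n≤1+n u
  ... | false = ≤-refl

newLabel-≤ : ∀ N u cs w → rgsFrom u w ≡ true → All (_< N) w → u ≤ N → newLabel u cs w ≤ N
newLabel-≤ N u []           w       _ _          u≤N = u≤N
newLabel-≤ N u (suc _ ∷ cs) w       _ _          u≤N = u≤N
newLabel-≤ N u (zero ∷ cs)  []      _ _          u≤N = u≤N
newLabel-≤ N u (zero ∷ cs)  (x ∷ w) h (x<N ∷ a) u≤N with rgsFrom-∷⁻ u x w h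
... | inj₁ (x<u , h') rewrite rgsStep-< x<u = newLabel-≤ N u cs w h' a u≤N
... | inj₂ (refl , h') rewrite rgsStep-≡ x  = newLabel-≤ N (suc x) cs w h' a x<N

rgsFrom-replicate-++ : ∀ {b u} c v → b < u → rgsFrom u (replicate c b ++ v) ≡ rgsFrom u v
rgsFrom-replicate-++ zero    v b<u = refl
rgsFrom-replicate-++ {b} {u} (suc c) v b<u rewrite rgsFrom-∷-< {u} (replicate c b ++ v) b<u = rgsFrom-replicate-++ c v b<u

rgsFrom-insertBlock-≤ : ∀ b u cs w → rgsFrom u w ≡ true → b ≤ u → rgsFrom (suc u) (insertBlock b cs w) ≡ true
rgsFrom-insertBlock-≤ b u []       w       h b≤u = refl
rgsFrom-insertBlock-≤ b u (c ∷ cs) []      h b≤u =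
  trans (cong (rgsFrom (suc u)) (sym (Listₚ.++-identityʳ (replicate c b)))) (rgsFrom-replicate-++ c [] (s≤s b≤u))
rgsFrom-insertBlock-≤ b u (c ∷ cs) (x ∷ w) h b≤u
  rewrite rgsFrom-replicate-++ {b} {suc u} c (punchIn b x ∷ insertBlock b cs w) (s≤s b≤u) with rgsFrom-∷⁻ u x w h
... | inj₁ (x<u , h') rewrite rgsFrom-∷-< {suc u} (insertBlock b cs w) (≤-<-trans (punchIn≤suc b x) (s≤s x<u)) =
  rgsFrom-insertBlock-≤ b u cs w h' b≤u
... | inj₂ (refl , h') rewrite punchIn-≥ {b} {x} b≤u | rgsFrom-∷-≡ (suc x) (insertBlock b cs w) =
  rgsFrom-insertBlock-≤ b (suc x) cs w h' (m≤n⇒m≤1+n b≤u)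

rgsFrom-insertBlock : ∀ u cs w → rgsFrom u w ≡ true → rgsFrom u (insertBlock (newLabel u cs w) cs w) ≡ true
rgsFrom-insertBlock u []           w       h = refl
rgsFrom-insertBlock u (suc c ∷ cs) w       h rewrite insertBlock-suc u c cs w | rgsFrom-∷-≡ u (insertBlock u (c ∷ cs) w) =
  rgsFrom-insertBlock-≤ u u (c ∷ cs) w h ≤-refl
rgsFrom-insertBlock u (zero ∷ cs)  []      h = refl
rgsFrom-insertBlock u (zero ∷ cs)  (x ∷ w) h with rgsFrom-∷⁻ u x w h
... | inj₁ (x<u , h') rewrite rgsStep-< x<u | punchIn-< {newLabel u cs w} {x} (<-≤-trans x<u (≤-newLabel u cs w))
                            | rgsFrom-∷-< (insertBlock (newLabel u cs w) cs w) x<u = rgsFrom-insertBlock u cs w h'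
... | inj₂ (refl , h') rewrite rgsStep-≡ x | punchIn-< {newLabel (suc x) cs w} {x} (≤-newLabel (suc x) cs w)
                            | rgsFrom-∷-≡ x (insertBlock (newLabel (suc x) cs w) cs w) = rgsFrom-insertBlock (suc x) cs w h'

-- Number of labels in use once block e is removed from a prefix that used u labels.
labelsWithout : ℕ → ℕ → ℕ
labelsWithout e u = if e <ᵇ u then u ∸ 1 else u

labelsWithout-> : ∀ {e u} → e < u → labelsWithout e u ≡ u ∸ 1
labelsWithout-> e<u rewrite <ᵇ-true e<u = refl

labelsWithout-≤ : ∀ {e u} → u ≤ e → labelsWithout e u ≡ u
labelsWithout-≤ {e} {u} u≤e rewrite <ᵇ-false {e} {u} (≤⇒≯ u≤e) = refl

punchOut-<-labelsWithout : ∀ e u x → x < u → x ≢ e → punchOut e x < labelsWithout e u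
punchOut-<-labelsWithout e u x x<u x≢e with <-cmp e u
... | tri≈ _ refl _ rewrite labelsWithout-≤ {e} {e} ≤-refl | punchOut-< x<u = x<u
... | tri> _ _ u<e rewrite labelsWithout-≤ (<⇒≤ u<e) | punchOut-< (<-trans x<u u<e) = x<u
... | tri< e<u _ _ rewrite labelsWithout-> e<u with <-cmp x e
...   | tri< x<e _ _ rewrite punchOut-< x<e = <-≤-trans x<e (∸-monoˡ-≤ 1 e<u)
...   | tri≈ _ x≡e _ = ⊥-elim (x≢e x≡e)
...   | tri> _ _ e<x rewrite punchOut-≥ {e} {x} (<⇒≤ e<x) = ∸-monoˡ-< x<u (≤-trans (s≤s z≤n) e<x)

rgsFrom-removeBlock : ∀ e u w → rgsFrom u w ≡ true → rgsFrom (labelsWithout e u) (removeBlock e w) ≡ true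
rgsFrom-removeBlock e u []      h = refl
rgsFrom-removeBlock e u (x ∷ w) h with rgsFrom-∷⁻ u x w h | e ≡ᵇ x in e≡ᵇx
... | inj₁ (x<u , h') | true  = rgsFrom-removeBlock e u w h'
... | inj₁ (x<u , h') | false
  rewrite rgsFrom-∷-< (removeBlock e w) (punchOut-<-labelsWithout e u x x<u (≡ᵇ-false⇒≢ e≡ᵇx ∘ sym)) =
  rgsFrom-removeBlock e u w h'
... | inj₂ (refl , h') | true with refl ← ≡ᵇ-sound {e} {x} e≡ᵇx rewrite labelsWithout-≤ {x} {x} ≤-refl =
  subst (λ v → rgsFrom v (removeBlock x w) ≡ true) (labelsWithout-> (n<1+n x)) (rgsFrom-removeBlock x (suc x) w h')
... | inj₂ (refl , h') | false with <-cmp e x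
...   | tri≈ _ e≡x _ = ⊥-elim (≡ᵇ-false⇒≢ e≡ᵇx e≡x)
...   | tri> _ _ x<e rewrite labelsWithout-≤ (<⇒≤ x<e) | punchOut-< x<e | rgsFrom-∷-≡ x (removeBlock e w) =
  subst (λ v → rgsFrom v (removeBlock e w) ≡ true) (labelsWithout-≤ x<e) (rgsFrom-removeBlock e (suc x) w h')
...   | tri< e<x _ _ rewrite labelsWithout-> e<x | punchOut-≥ {e} {x} (<⇒≤ e<x) = goal
  where
  suc[x∸1]≡x : suc (x ∸ 1) ≡ x
  suc[x∸1]≡x = trans (+-comm 1 (x ∸ 1)) (m∸n+n≡m (≤-trans (s≤s z≤n) e<x))
  goal : rgsFrom (x ∸ 1) ((x ∸ 1) ∷ removeBlock e w) ≡ true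
  goal rewrite rgsFrom-∷-≡ (x ∸ 1) (removeBlock e w) | suc[x∸1]≡x =
    subst (λ v → rgsFrom v (removeBlock e w) ≡ true) (labelsWithout-> (m<n⇒m<1+n e<x)) (rgsFrom-removeBlock e (suc x) w h')

newLabel-removeBlock : ∀ e u w → rgsFrom u w ≡ true → u ≤ e → e ∈ w → newLabel u (gaps e w) (removeBlock e w) ≡ e
newLabel-removeBlock e u (x ∷ w) h u≤e e∈x∷w with e ≡ᵇ x in e≡ᵇx | gaps-∷ e w
... | true | h′ , t , eq rewrite eq with rgsFrom-∷⁻ u x w h
...   | inj₁ (x<u , _) = ⊥-elim (<⇒≱ x<u (subst (u ≤_) (≡ᵇ-sound e≡ᵇx) u≤e))
...   | inj₂ (x≡u , _) = trans (sym x≡u) (sym (≡ᵇ-sound e≡ᵇx))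
newLabel-removeBlock e u (x ∷ w) h u≤e (here e≡x)    | false | _ = ⊥-elim (≡ᵇ-false⇒≢ e≡ᵇx e≡x)
newLabel-removeBlock e u (x ∷ w) h u≤e (there e∈w) | false | _ with rgsFrom-∷⁻ u x w h
... | inj₁ (x<u , h') rewrite punchOut-< {e} {x} (<-≤-trans x<u u≤e) | rgsStep-< x<u = newLabel-removeBlock e u w h' u≤e e∈w
... | inj₂ (refl , h') with x<e ← ≤∧≢⇒< u≤e (≡ᵇ-false⇒≢ e≡ᵇx ∘ sym) rewrite punchOut-< {e} {x} x<e | rgsStep-≡ x =
  newLabel-removeBlock e (suc x) w h' x<e e∈w

-- Counting gap vectors

count-words-suc : ∀ L m (P : List ℕ → Bool) → count P (words (suc L) (suc m)) ≡
  count (P ∘ (0 ∷_)) (words L (suc m)) + ∑ m (λ x → count (P ∘ (suc x ∷_)) (words L (suc m)))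
count-words-suc L m P = begin
  count P (concatMap (λ w → map (_∷ w) (upTo (suc m))) W)              ≡⟨ count-concatMap P _ W ⟩
  sum (map (λ w → count P (map (_∷ w) (upTo (suc m)))) W)             ≡⟨ sum-map-cong W (λ w →
                                                                          trans (count-map P (_∷ w) (upTo (suc m)))
                                                                                (count≡sum (P ∘ (_∷ w)) (upTo (suc m)))) ⟩
  sum (map (λ w → sum (map (λ x → 𝟙 (P (x ∷ w))) (upTo (suc m)))) W) ≡⟨ sum-map-comm (λ w x → 𝟙 (P (x ∷ w))) W (upTo (suc m)) ⟩
  sum (map (λ x → sum (map (λ w → 𝟙 (P (x ∷ w))) W)) (upTo (suc m))) ≡⟨ sum-map-cong (upTo (suc m)) (λ x → sym (count≡sum _ W)) ⟩
  sum (map (λ x → count (P ∘ (x ∷_)) W) (upTo (suc m)))                ≡⟨ sum-map-upTo (suc m) _ ⟩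
  ∑ (suc m) (λ x → count (P ∘ (x ∷_)) W)                               ≡⟨ ∑-suc m _ ⟩
  count (P ∘ (0 ∷_)) W + ∑ m (λ x → count (P ∘ (suc x ∷_)) W)          ∎
  where
  open ≡-Reasoning
  W : List (List ℕ)
  W = words L (suc m)

nonzeros : List ℕ → ℕ
nonzeros []           = 0
nonzeros (zero ∷ cs)  = nonzeros cs
nonzeros (suc _ ∷ cs) = suc (nonzeros cs)

runLoops+nonzeros : ∀ cs → runLoops cs + nonzeros cs ≡ sum cs
runLoops+nonzeros []           = refl
runLoops+nonzeros (zero ∷ cs)  = runLoops+nonzeros cs
runLoops+nonzeros (suc c ∷ cs) = trans (+-suc (c + runLoops cs) (nonzeros cs))
  (cong suc (trans (+-assoc c (runLoops cs) (nonzeros cs)) (cong (c +_) (runLoops+nonzeros cs))))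

admissible : List Bool → ℕ → ℕ → List ℕ → Bool
admissible fs s j cs = (sum cs ≡ᵇ s) ∧ ((nonzeros cs ≡ᵇ j) ∧ (flaggedZeros fs cs ≡ᵇ 0))

-- The number of j-element sets of positions containing every flagged position.
supports : List Bool → ℕ → ℕ
supports []       zero    = 1
supports []       (suc j) = 0
supports (f ∷ fs) zero    = 𝟙 (not f) * supports fs zero
supports (f ∷ fs) (suc j) = 𝟙 (not f) * supports fs (suc j) + supports fs j

-- The number of compositions of s into j positive parts, each at most d.
compositions : ℕ → ℕ → ℕ → ℕ
compositions d s zero    = 𝟙 (s ≡ᵇ 0)
compositions d s (suc j) = ∑ d (λ x → if suc x ≤ᵇ s then compositions d (s ∸ suc x) j else 0)

count-admissible-0∷ : ∀ d f fs s j →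
  count (admissible (f ∷ fs) s j ∘ (0 ∷_)) (words (length fs) (suc d)) ≡
  𝟙 (not f) * count (admissible fs s j) (words (length fs) (suc d))
count-admissible-0∷ d false fs s j = sym (+-identityʳ _)
count-admissible-0∷ d true  fs s j = count-false _ (words (length fs) (suc d)) (λ w →
  trans (cong ((sum w ≡ᵇ s) ∧_) (Boolₚ.∧-zeroʳ (nonzeros w ≡ᵇ j))) (Boolₚ.∧-zeroʳ (sum w ≡ᵇ s)))

count-admissible-suc∷ : ∀ d f fs s j x →
  count (admissible (f ∷ fs) s (suc j) ∘ (suc x ∷_)) (words (length fs) (suc d)) ≡
  supports fs j * (if suc x ≤ᵇ s then compositions d (s ∸ suc x) j else 0)

count-admissible : ∀ d fs s j → count (admissible fs s j) (words (length fs) (suc d)) ≡ supports fs j * compositions d s j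
count-admissible d []       zero    zero    = refl
count-admissible d []       (suc s) zero    = refl
count-admissible d []       zero    (suc j) = refl
count-admissible d []       (suc s) (suc j) = refl
count-admissible d (f ∷ fs) s zero
  rewrite count-words-suc (length fs) d (admissible (f ∷ fs) s zero) | count-admissible-0∷ d f fs s zero
        | count-admissible d fs s zero
        | ∑-cong d {g = λ _ → 0} (λ x _ → count-false _ (words (length fs) (suc d)) (λ w → Boolₚ.∧-zeroʳ (sum (suc x ∷ w) ≡ᵇ s)))
        | ∑-zero d =
  trans (+-identityʳ _) (sym (*-assoc (𝟙 (not f)) (supports fs zero) _))
count-admissible d (f ∷ fs) s (suc j)
  rewrite count-words-suc (length fs) d (admissible (f ∷ fs) s (suc j)) | count-admissible-0∷ d f fs s (suc j)
        | count-admissible d fs s (suc j) | ∑-cong d (λ x _ → count-admissible-suc∷ d f fs s j x)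
        | ∑-*ˡ d (supports fs j) (λ x → if suc x ≤ᵇ s then compositions d (s ∸ suc x) j else 0) =
  trans (cong (_+ supports fs j * compositions d s (suc j)) (sym (*-assoc (𝟙 (not f)) (supports fs (suc j)) _)))
        (sym (*-distribʳ-+ (compositions d s (suc j)) (𝟙 (not f) * supports fs (suc j)) (supports fs j)))

count-admissible-suc∷ d f fs s j x = begin
  count (admissible (f ∷ fs) s (suc j) ∘ (suc x ∷_)) W
    ≡⟨ count-cong {xs = W} (All.tabulate (λ {w} _ → split w)) ⟩
  count (λ w → (suc x ≤ᵇ s) ∧ admissible fs (s ∸ suc x) j w) W
    ≡⟨ count-∧ˡ (suc x ≤ᵇ s) (admissible fs (s ∸ suc x) j) W ⟩
  (if suc x ≤ᵇ s then count (admissible fs (s ∸ suc x) j) W else 0)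
    ≡⟨ cong (if suc x ≤ᵇ s then_else 0) (count-admissible d fs (s ∸ suc x) j) ⟩
  (if suc x ≤ᵇ s then supports fs j * compositions d (s ∸ suc x) j else 0)
    ≡⟨ if-*ˡ (suc x ≤ᵇ s) {supports fs j} ⟩
  supports fs j * (if suc x ≤ᵇ s then compositions d (s ∸ suc x) j else 0) ∎
  where
  open ≡-Reasoning
  W : List (List ℕ)
  W = words (length fs) (suc d)
  split : ∀ w → admissible (f ∷ fs) s (suc j) (suc x ∷ w) ≡ (suc x ≤ᵇ s) ∧ admissible fs (s ∸ suc x) j w
  split w rewrite +-≡ᵇ (suc x) (sum w) s = Boolₚ.∧-assoc (suc x ≤ᵇ s) _ _
  if-*ˡ : ∀ b {a y} → (if b then a * y else 0) ≡ a * (if b then y else 0)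
  if-*ˡ true          = refl
  if-*ˡ false {a} = sym (*-zeroʳ a)

supports-closedForm : ∀ fs j → supports fs j ≡ (if trues fs ≤ᵇ j then (length fs ∸ trues fs) C (j ∸ trues fs) else 0)
supports-closedForm []           zero    = refl
supports-closedForm []           (suc j) = refl
supports-closedForm (true ∷ fs)  zero    = refl
supports-closedForm (false ∷ fs) zero    rewrite +-identityʳ (supports fs zero) | supports-closedForm fs zero | 0∸n≡0 (trues fs) = refl
supports-closedForm (true ∷ fs)  (suc j) rewrite supports-closedForm fs j | ≤ᵇ-suc (trues fs) j = refl
supports-closedForm (false ∷ fs) (suc j)
  rewrite +-identityʳ (supports fs (suc j)) | supports-closedForm fs (suc j) | supports-closedForm fs j with <-cmp (trues fs) (suc j)
... | tri< t<1+j _ _ rewrite ≤ᵇ-true (<⇒≤ t<1+j) | ≤ᵇ-true (s≤s⁻¹ t<1+j) = pascal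
  where
  L : ℕ
  L = length fs
  t : ℕ
  t = trues fs
  open ≡-Reasoning
  pascal : (L ∸ t) C (suc j ∸ t) + (L ∸ t) C (j ∸ t) ≡ (suc L ∸ t) C (suc j ∸ t)
  pascal = begin
    (L ∸ t) C (suc j ∸ t) + (L ∸ t) C (j ∸ t)  ≡⟨ cong (λ z → (L ∸ t) C z + (L ∸ t) C (j ∸ t)) (+-∸-assoc 1 (s≤s⁻¹ t<1+j)) ⟩
    (L ∸ t) C suc (j ∸ t) + (L ∸ t) C (j ∸ t)  ≡⟨ +-comm _ ((L ∸ t) C (j ∸ t)) ⟩
    (L ∸ t) C (j ∸ t) + (L ∸ t) C suc (j ∸ t)  ≡⟨ nCk+nC[k+1]≡[n+1]C[k+1] (L ∸ t) (j ∸ t) ⟩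
    suc (L ∸ t) C suc (j ∸ t)                  ≡⟨ cong₂ _C_ (sym (+-∸-assoc 1 (trues≤length fs))) (sym (+-∸-assoc 1 (s≤s⁻¹ t<1+j))) ⟩
    (suc L ∸ t) C (suc j ∸ t)                  ∎
... | tri≈ _ t≡1+j _ rewrite ≤ᵇ-true (≤-reflexive t≡1+j) | ≤ᵇ-false {trues fs} {j} (<⇒≱ (≤-reflexive (sym t≡1+j)))
                           | t≡1+j | n∸n≡0 (suc j) = refl
... | tri> _ _ 1+j<t rewrite ≤ᵇ-false (<⇒≱ 1+j<t) | ≤ᵇ-false {trues fs} {j} (<⇒≱ 1+j<t ∘ m≤n⇒m≤1+n) = refl

-- Stars and bars: the bound d on the parts is inactive as soon as s ≤ d.
compositions-closedForm : ∀ d s j → suc s ≤ d → compositions d (suc s) (suc j) ≡ s C j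
compositions-closedForm d s j 1+s≤d =
  trans (∑-reflect d (suc s) (λ t → compositions d t j) 1+s≤d) (trans (∑-suc s (λ t → compositions d t j)) (lastPart j))
  where
  lastPart : ∀ j → compositions d 0 j + ∑ s (λ t → compositions d (suc t) j) ≡ s C j
  lastPart zero    = cong suc (∑-zero s)
  lastPart (suc j) = trans (cong₂ _+_ (∑-zero d) (∑-cong s (λ t t<s → compositions-closedForm d t j (≤-trans (s≤s (<⇒≤ t<s)) 1+s≤d))))
                           (∑-C-hockeyStick s j)

-- Decomposing a diagram along its loop block

isDiagram⁻ : ∀ m d w → isDiagram m d w ≡ true → rgsFrom 0 w ≡ true × (∀ {y} → y < m → occ y w ≡ d)
isDiagram⁻ m d w h with r , o ← ∧-split {rgsFrom 0 w} h = r , λ y<m → ≡ᵇ-sound (all-upTo⁻ _ m o y<m)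

isDiagram⁺ : ∀ m d w → rgsFrom 0 w ≡ true → (∀ {y} → y < m → occ y w ≡ d) → isDiagram m d w ≡ true
isDiagram⁺ m d w r o = ∧-intro r (all-upTo⁺ _ m (≡ᵇ-true ∘ o))

good : ℕ → ℕ → ℕ → List ℕ → Bool
good n d k w = isDiagram n d w ∧ ((loops w ≡ᵇ k) ∧ loopsInOneBlock n w)

loopBlocks-∷⁺ : ∀ w → 1 ≤ loops w → ∃ λ h → ∃ λ t → loopBlocks w ≡ h ∷ t
loopBlocks-∷⁺ w 1≤loops with loopBlocks w
... | h ∷ t = h , t , refl

loopBlock : List ℕ → ℕ
loopBlock w with loopBlocks w
... | []    = 0
... | h ∷ _ = h

loopBlock-∷ : ∀ w {h t} → loopBlocks w ≡ h ∷ t → loopBlock w ≡ h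
loopBlock-∷ w eq with loopBlocks w
loopBlock-∷ w refl | _ ∷ _ = refl

loopBlock-all : ∀ w i → 1 ≤ loops w → all (_≡ᵇ i) (loopBlocks w) ≡ true → loopBlock w ≡ i
loopBlock-all w i 1≤loops h with loopBlocks w
loopBlock-all w i ()      h | []
... | h₀ ∷ _ = ≡ᵇ-sound (proj₁ (∧-split {h₀ ≡ᵇ i} h))

reduced : List ℕ → List ℕ
reduced w = removeBlock (loopBlock w) w

loopGaps : List ℕ → List ℕ
loopGaps w = gaps (loopBlock w) w

reassemble : List ℕ → List ℕ → List ℕ
reassemble w' cs = insertBlock (newLabel 0 cs w') cs w'

reassemble-decompose : ∀ n d k w → 1 ≤ k → good n d k w ≡ true → reassemble (reduced w) (loopGaps w) ≡ w
reassemble-decompose n d k w 1≤k g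
  with isDiag , rest ← ∧-split {isDiagram n d w} g
  with loops≡ᵇk , _ ← ∧-split {loops w ≡ᵇ k} rest
  with h , t , eq ← loopBlocks-∷⁺ w (subst (1 ≤_) (sym (≡ᵇ-sound loops≡ᵇk)) 1≤k)
  rewrite loopBlock-∷ w eq
        | newLabel-removeBlock h 0 w (proj₁ (isDiagram⁻ n d w isDiag)) z≤n (loopBlocks-∈ w eq) =
  insertBlock-gaps-removeBlock h w

module Decomposition (n d k : ℕ) (1≤k : 1 ≤ k) (w : List ℕ)
                     (g : good (suc n) d k w ≡ true) (isWord : IsWord (suc n * d) (suc n) w) where

  private
    isDiag : isDiagram (suc n) d w ≡ true
    isDiag = proj₁ (∧-split {isDiagram (suc n) d w} g)

    loops≡k : loops w ≡ k
    loops≡k = ≡ᵇ-sound (proj₁ (∧-split {loops w ≡ᵇ k} (proj₂ (∧-split {isDiagram (suc n) d w} g))))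

    e : ℕ
    e = loopBlock w

    e∈w : e ∈ w
    e∈w with h , t , eq ← loopBlocks-∷⁺ w (subst (1 ≤_) (sym loops≡k) 1≤k) rewrite loopBlock-∷ w eq = loopBlocks-∈ w eq

    e<1+n : e < suc n
    e<1+n = All.lookup (proj₂ isWord) e∈w

    occ≡d : ∀ {y} → y < suc n → occ y w ≡ d
    occ≡d = proj₂ (isDiagram⁻ (suc n) d w isDiag)

  reduced-isDiagram : isDiagram n d (reduced w) ≡ true
  reduced-isDiagram = isDiagram⁺ n d (reduced w)
    (subst (λ v → rgsFrom v (reduced w) ≡ true) (labelsWithout-≤ {e} z≤n) (rgsFrom-removeBlock e 0 w (proj₁ (isDiagram⁻ (suc n) d w isDiag))))
    (λ {y} y<n → trans (occ-removeBlock e y w) (occ≡d (≤-<-trans (punchIn≤suc e y) (s≤s y<n))))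

  length-reduced : length (reduced w) ≡ n * d
  length-reduced = +-cancelʳ-≡ d (length (reduced w)) (n * d) (begin
    length (reduced w) + d        ≡⟨ cong (length (reduced w) +_) (sym (occ≡d e<1+n)) ⟩
    length (reduced w) + occ e w  ≡⟨ length-removeBlock e w ⟩
    length w                      ≡⟨ proj₁ isWord ⟩
    d + n * d                     ≡⟨ +-comm d (n * d) ⟩
    n * d + d                     ∎)
    where open ≡-Reasoning

  reduced-isWord : IsWord (n * d) n (reduced w)
  reduced-isWord = length-reduced , removeBlock-< n e w e<1+n (proj₂ isWord)

  loopGaps-isWord : IsWord (suc (n * d)) (suc d) (loopGaps w)
  loopGaps-isWord = trans (length-gaps e w) (cong suc length-reduced)
                  , All.map (λ q → s≤s (subst (_ ≤_) (occ≡d e<1+n) q)) (gaps-≤-occ e w)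

reassembles : ℕ → ℕ → ℕ → List ℕ → List ℕ → Bool
reassembles n d k w' cs =
  isWord? (n * d) n (reassemble w' cs) ∧
  (good n d k (reassemble w' cs) ∧ (eqList (reduced (reassemble w' cs)) w' ∧ eqList (loopGaps (reassemble w' cs)) cs))

module Reassembly (n d k : ℕ) (1≤k : 1 ≤ k) (k<d : k < d)
                  (w' : List ℕ) (isDiag' : isDiagram n d w' ≡ true) (isWord' : IsWord (n * d) n w')
                  (cs : List ℕ) (length-cs : length cs ≡ suc (length w')) where

  private
    b : ℕ
    b = newLabel 0 cs w'
    v : List ℕ
    v = reassemble w' cs
    fz : ℕ
    fz = flaggedZeros (loopFlags w') cs

    b<1+n : b < suc n
    b<1+n = s≤s (newLabel-≤ n 0 cs w' (proj₁ (isDiagram⁻ n d w' isDiag')) (proj₂ isWord') z≤n)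

    runLoops-nonzeros : sum cs ≡ d → runLoops cs ≡ k → nonzeros cs ≡ d ∸ k
    runLoops-nonzeros Σ≡d r≡k = trans (sym (m+n∸m≡n (runLoops cs) (nonzeros cs)))
                                      (cong₂ _∸_ (trans (runLoops+nonzeros cs) Σ≡d) r≡k)

    nonzeros-runLoops : sum cs ≡ d → nonzeros cs ≡ d ∸ k → runLoops cs ≡ k
    nonzeros-runLoops Σ≡d nz≡ = trans (sym (m+n∸n≡m (runLoops cs) (nonzeros cs)))
      (trans (cong₂ _∸_ (trans (runLoops+nonzeros cs) Σ≡d) nz≡) (m∸[m∸n]≡n (<⇒≤ k<d)))

  reassembles⇒admissible : reassembles (suc n) d k w' cs ≡ true → admissible (loopFlags w') d (d ∸ k) cs ≡ true
  reassembles⇒admissible h = ∧-intro (≡ᵇ-true Σ≡d) (∧-intro (≡ᵇ-true (runLoops-nonzeros Σ≡d runLoops≡k)) (≡ᵇ-true fz≡0))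
    where
    h₂ : good (suc n) d k v ∧ (eqList (reduced v) w' ∧ eqList (loopGaps v) cs) ≡ true
    h₂ = proj₂ (∧-split {isWord? (suc n * d) (suc n) v} h)
    good-v : good (suc n) d k v ≡ true
    good-v = proj₁ (∧-split {good (suc n) d k v} h₂)
    isDiag : isDiagram (suc n) d v ≡ true
    isDiag = proj₁ (∧-split {isDiagram (suc n) d v} good-v)
    loops-oneBlock : (loops v ≡ᵇ k) ∧ loopsInOneBlock (suc n) v ≡ true
    loops-oneBlock = proj₂ (∧-split {isDiagram (suc n) d v} good-v)
    loops≡k : loops v ≡ k
    loops≡k = ≡ᵇ-sound (proj₁ (∧-split {loops v ≡ᵇ k} loops-oneBlock))
    1≤loops : 1 ≤ loops v
    1≤loops = subst (1 ≤_) (sym loops≡k) 1≤k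
    loopGaps≡cs : gaps (loopBlock v) v ≡ cs
    loopGaps≡cs = eqList-sound _ _ (proj₂ (∧-split {eqList (reduced v) w'} (proj₂ (∧-split {good (suc n) d k v} h₂))))
    Σ≡d : sum cs ≡ d
    Σ≡d = trans (sym (occ-insertBlock-new b cs w' length-cs)) (proj₂ (isDiagram⁻ (suc n) d v isDiag) b<1+n)
    loopBlock≡b : loopBlock v ≡ b
    loopBlock≡b with loopBlock v ≟ b
    ... | yes eq  = eq
    ... | no  neq = ⊥-elim (<⇒≢ (≤-<-trans z≤n k<d)
                      (sym (trans (sym Σ≡d) (gaps-insertBlock-other (loopBlock v) b cs w' (neq ∘ sym) length-cs loopGaps≡cs))))
    allInB : all (_≡ᵇ b) (loopBlocks v) ≡ true
    allInB with i , _ , allInI ← any-upTo⁻ (λ i → all (_≡ᵇ i) (loopBlocks v)) (suc n) (proj₂ (∧-split {loops v ≡ᵇ k} loops-oneBlock)) =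
      subst (λ z → all (_≡ᵇ z) (loopBlocks v) ≡ true) (trans (sym (loopBlock-all v i 1≤loops allInI)) loopBlock≡b) allInI
    fz≡0 : fz ≡ 0
    fz≡0 = ≡ᵇ-sound (trans (sym (all-loopBlocks-insertBlock b cs w' length-cs)) allInB)
    runLoops≡k : runLoops cs ≡ k
    runLoops≡k = trans (sym (+-identityʳ (runLoops cs)))
      (trans (cong (runLoops cs +_) (sym fz≡0)) (trans (sym (loops-insertBlock b cs w' length-cs)) loops≡k))

  admissible⇒reassembles : admissible (loopFlags w') d (d ∸ k) cs ≡ true → reassembles (suc n) d k w' cs ≡ true
  admissible⇒reassembles h =
    ∧-intro (isWord?-complete _ _ v (length-v , insertBlock-< n b cs w' (proj₂ isWord') b<1+n))
     (∧-intro (∧-intro isDiag (∧-intro (≡ᵇ-true loops≡k) oneBlock))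
       (∧-intro (subst (λ z → eqList (removeBlock z v) w' ≡ true) (sym loopBlock≡b)
                       (subst (λ z → eqList z w' ≡ true) (sym (removeBlock-insertBlock b cs w' length-cs)) (eqList-refl w')))
                (subst (λ z → eqList (gaps z v) cs ≡ true) (sym loopBlock≡b)
                       (subst (λ z → eqList z cs ≡ true) (sym (gaps-insertBlock b cs w' length-cs)) (eqList-refl cs)))))
    where
    Σ≡d : sum cs ≡ d
    Σ≡d = ≡ᵇ-sound (proj₁ (∧-split {sum cs ≡ᵇ d} h))
    h₂ : (nonzeros cs ≡ᵇ d ∸ k) ∧ (fz ≡ᵇ 0) ≡ true
    h₂ = proj₂ (∧-split {sum cs ≡ᵇ d} h)
    fz≡0 : fz ≡ 0
    fz≡0 = ≡ᵇ-sound (proj₂ (∧-split {nonzeros cs ≡ᵇ d ∸ k} h₂))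
    nonzeros≡ : nonzeros cs ≡ d ∸ k
    nonzeros≡ = ≡ᵇ-sound (proj₁ (∧-split {nonzeros cs ≡ᵇ d ∸ k} h₂))
    loops≡k : loops v ≡ k
    loops≡k = trans (loops-insertBlock b cs w' length-cs)
      (trans (cong (runLoops cs +_) fz≡0) (trans (+-identityʳ _) (nonzeros-runLoops Σ≡d nonzeros≡)))
    allInB : all (_≡ᵇ b) (loopBlocks v) ≡ true
    allInB = trans (all-loopBlocks-insertBlock b cs w' length-cs) (≡ᵇ-true fz≡0)
    loopBlock≡b : loopBlock v ≡ b
    loopBlock≡b = loopBlock-all v b (subst (1 ≤_) (sym loops≡k) 1≤k) allInB
    length-v : length v ≡ suc n * d
    length-v = trans (length-insertBlock b cs w' length-cs) (trans (cong₂ _+_ (proj₁ isWord') Σ≡d) (+-comm (n * d) d))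
    oneBlock : loopsInOneBlock (suc n) v ≡ true
    oneBlock = any-upTo⁺ (λ i → all (_≡ᵇ i) (loopBlocks v)) (suc n) b<1+n allInB
    occ≡d : ∀ {y} → y < suc n → occ y v ≡ d
    occ≡d {y} y<1+n with y ≟ b
    ... | yes refl = trans (occ-insertBlock-new b cs w' length-cs) Σ≡d
    ... | no  y≢b  = trans (occ-insertBlock-old y b cs w' y≢b length-cs)
                           (proj₂ (isDiagram⁻ n d w' isDiag') (punchOut-bound y<1+n b<1+n y≢b))
    isDiag : isDiagram (suc n) d v ≡ true
    isDiag = isDiagram⁺ (suc n) d v (rgsFrom-insertBlock 0 cs w' (proj₁ (isDiagram⁻ n d w' isDiag'))) occ≡d

  reassembles≡admissible : reassembles (suc n) d k w' cs ≡ admissible (loopFlags w') d (d ∸ k) cs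
  reassembles≡admissible = ≡true-ext reassembles⇒admissible admissible⇒reassembles

module Counting (d n k : ℕ) (1≤k : 1 ≤ k) (k<d : k < d) where

  private
    W : List (List ℕ)
    W = words (suc n * d) (suc n)
    Gaps : List (List ℕ)
    Gaps = words (suc (n * d)) (suc d)
    j : ℕ
    j = d ∸ k
    g : List ℕ → Bool
    g = good (suc n) d k

    W-isWord : All (IsWord (suc n * d) (suc n)) W
    W-isWord = words-isWord (suc n * d) (suc n)

    diagrams-isWord : All (λ w' → isDiagram n d w' ≡ true × IsWord (n * d) n w') (diagrams n d)
    diagrams-isWord = All.zip ( All.map T⇒≡true (Allₚ.all-filter (Boolₚ.T? ∘ isDiagram n d) (words (n * d) n))
                              , Allₚ.filter⁺ (Boolₚ.T? ∘ isDiagram n d) (words-isWord (n * d) n))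

  -- Since w ↦ (reduced w, loopGaps w) has the left inverse reassemble, each fibre has at most one element.
  fibre≡ : ∀ w' cs w → IsWord (suc n * d) (suc n) w →
    (g w ∧ eqList (reduced w) w') ∧ eqList (loopGaps w) cs ≡ eqList (reassemble w' cs) w ∧ reassembles (suc n) d k w' cs
  fibre≡ w' cs w isWord = ≡true-ext to from
    where
    to : (g w ∧ eqList (reduced w) w') ∧ eqList (loopGaps w) cs ≡ true → eqList (reassemble w' cs) w ∧ reassembles (suc n) d k w' cs ≡ true
    to h with h₁₂ , h₃ ← ∧-split {g w ∧ eqList (reduced w) w'} h
         with gw , h₂ ← ∧-split {g w} h₁₂
         with refl ← eqList-sound (reduced w) w' h₂ | refl ← eqList-sound (loopGaps w) cs h₃
         rewrite reassemble-decompose (suc n) d k w 1≤k gw =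
      ∧-intro (eqList-refl w) (∧-intro (isWord?-complete _ _ w isWord) (∧-intro gw (∧-intro (eqList-refl (reduced w)) (eqList-refl (loopGaps w)))))
    from : eqList (reassemble w' cs) w ∧ reassembles (suc n) d k w' cs ≡ true → (g w ∧ eqList (reduced w) w') ∧ eqList (loopGaps w) cs ≡ true
    from h with h₁ , hv ← ∧-split {eqList (reassemble w' cs) w} h
           with refl ← eqList-sound (reassemble w' cs) w h₁
           with _ , hv₂ ← ∧-split {isWord? (suc n * d) (suc n) (reassemble w' cs)} hv
           with gv , hv₃ ← ∧-split {g (reassemble w' cs)} hv₂
           with ha , hb ← ∧-split {eqList (reduced (reassemble w' cs)) w'} hv₃ =
      ∧-intro (∧-intro gv ha) hb

  count-fibre : ∀ w' cs → count (λ w → (g w ∧ eqList (reduced w) w') ∧ eqList (loopGaps w) cs) W ≡ 𝟙 (reassembles (suc n) d k w' cs)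
  count-fibre w' cs = trans (count-cong (All.map (fibre≡ w' cs _) W-isWord))
    (trans (count-∧ʳ (eqList (reassemble w' cs)) (reassembles (suc n) d k w' cs) W) (atMostOne (reassembles (suc n) d k w' cs) refl))
    where
    atMostOne : ∀ r → reassembles (suc n) d k w' cs ≡ r → count (eqList (reassemble w' cs)) W * 𝟙 r ≡ 𝟙 r
    atMostOne false _ = *-zeroʳ (count (eqList (reassemble w' cs)) W)
    atMostOne true  h = trans (*-identityʳ _) (count-eqList-words (suc n * d) (suc n) (reassemble w' cs)
      (isWord?-sound _ _ _ (proj₁ (∧-split {isWord? (suc n * d) (suc n) (reassemble w' cs)} h))))

  count-good-over : ∀ w' → isDiagram n d w' ≡ true → IsWord (n * d) n w' →
    count (λ w → g w ∧ eqList (reduced w) w') W ≡ supports (loopFlags w') j * compositions d d j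
  count-good-over w' isDiag' isWord' = begin
    count (λ w → g w ∧ eqList (reduced w) w') W
      ≡⟨ count-fibres (λ w → g w ∧ eqList (reduced w) w') loopGaps eqList W Gaps (All.map loopGaps-unique W-isWord) ⟩
    sum (map (λ cs → count (λ w → (g w ∧ eqList (reduced w) w') ∧ eqList (loopGaps w) cs) W) Gaps)
      ≡⟨ sum-map-cong Gaps (count-fibre w') ⟩
    sum (map (𝟙 ∘ reassembles (suc n) d k w') Gaps)
      ≡⟨ sym (count≡sum _ Gaps) ⟩
    count (reassembles (suc n) d k w') Gaps
      ≡⟨ count-cong (All.map (λ {cs} isWordᶜ → Reassembly.reassembles≡admissible n d k 1≤k k<d w' isDiag' isWord' cs
                                                 (trans (proj₁ isWordᶜ) (cong suc (sym (proj₁ isWord')))))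
                            (words-isWord (suc (n * d)) (suc d))) ⟩
    count (admissible (loopFlags w') d j) Gaps
      ≡⟨ cong (count (admissible (loopFlags w') d j) ∘ (λ L → words L (suc d))) (sym (trans (length-loopFlags w') (cong suc (proj₁ isWord')))) ⟩
    count (admissible (loopFlags w') d j) (words (length (loopFlags w')) (suc d))
      ≡⟨ count-admissible d (loopFlags w') d j ⟩
    supports (loopFlags w') j * compositions d d j ∎
    where
    open ≡-Reasoning
    loopGaps-unique : ∀ {w} → IsWord (suc n * d) (suc n) w → g w ∧ eqList (reduced w) w' ≡ true → count (eqList (loopGaps w)) Gaps ≡ 1
    loopGaps-unique {w} isWord h =
      count-eqList-words _ _ (loopGaps w) (Decomposition.loopGaps-isWord n d k 1≤k w (proj₁ (∧-split {g w} h)) isWord)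

  supports-loopFlags : ∀ w' → IsWord (n * d) n w' →
    supports (loopFlags w') j ≡ (if loops w' ≤ᵇ j then binomDiff (d * n + 1) (loops w') (j ∸ loops w') else 0)
  supports-loopFlags w' (length≡ , _)
    with loops≤ ← subst₂ _≤_ (trues-loopFlags w') (trans (length-loopFlags w') (cong suc length≡)) (trues≤length (loopFlags w'))
    rewrite supports-closedForm (loopFlags w') j | trues-loopFlags w' | length-loopFlags w' | length≡
          | trans (+-comm (d * n) 1) (cong suc (*-comm d n)) | ≤ᵇ-true loops≤ = refl

  aOne≡ : aOne d (suc n) k ≡ compositions d d j * sum (map (λ m → binomDiff (d * n + 1) m (j ∸ m) * a d n m) (upTo (suc j)))
  aOne≡ = begin
    aOne d (suc n) k
      ≡⟨ count-filterᵇ (isDiagram (suc n) d) _ W ⟩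
    count g W
      ≡⟨ count-fibres g reduced eqList W (diagrams n d) (All.map reduced-unique W-isWord) ⟩
    sum (map (λ w' → count (λ w → g w ∧ eqList (reduced w) w') W) (diagrams n d))
      ≡⟨ sum-map-congᴬ (All.map (λ (isDiag' , isWord') →
           trans (count-good-over _ isDiag' isWord') (*-comm _ (compositions d d j))) diagrams-isWord) ⟩
    sum (map (λ w' → compositions d d j * supports (loopFlags w') j) (diagrams n d))
      ≡⟨ sum-map-*ˡ (compositions d d j) (λ w' → supports (loopFlags w') j) (diagrams n d) ⟩
    compositions d d j * sum (map (λ w' → supports (loopFlags w') j) (diagrams n d))
      ≡⟨ cong (compositions d d j *_) (sum-map-congᴬ (All.map (supports-loopFlags _ ∘ proj₂) diagrams-isWord)) ⟩
    compositions d d j * sum (map (λ w' → if loops w' ≤ᵇ j then binomDiff (d * n + 1) (loops w') (j ∸ loops w') else 0) (diagrams n d))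
      ≡⟨ cong (compositions d d j *_) (sum-map-groupBy loops (λ m → binomDiff (d * n + 1) m (j ∸ m)) j (diagrams n d)) ⟩
    compositions d d j * ∑ (suc j) (λ m → binomDiff (d * n + 1) m (j ∸ m) * a d n m)
      ≡⟨ cong (compositions d d j *_) (sym (sum-map-upTo (suc j) _)) ⟩
    compositions d d j * sum (map (λ m → binomDiff (d * n + 1) m (j ∸ m) * a d n m) (upTo (suc j))) ∎
    where
    open ≡-Reasoning
    reduced-unique : ∀ {w} → IsWord (suc n * d) (suc n) w → g w ≡ true → count (eqList (reduced w)) (diagrams n d) ≡ 1
    reduced-unique {w} isWord gw = count-eqList-filterᵇ-words (isDiagram n d) (n * d) n (reduced w)
      (Decomposition.reduced-isDiagram n d k 1≤k w gw isWord) (Decomposition.reduced-isWord n d k 1≤k w gw isWord)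

mainTheorem3 : (d n k : ℕ) → 2 ≤ d → 1 ≤ n → 1 ≤ k → k ≤ d ∸ 1 →
    aOne d n k ≡ rhs d n k
mainTheorem3 (suc d) (suc n) k _ _ 1≤k k≤d = begin
  aOne (suc d) (suc n) k                                      ≡⟨ Counting.aOne≡ (suc d) n k 1≤k (s≤s k≤d) ⟩
  compositions (suc d) (suc d) (suc d ∸ k) * Σ                ≡⟨ cong (λ j → compositions (suc d) (suc d) j * Σ) (+-∸-assoc 1 k≤d) ⟩
  compositions (suc d) (suc d) (suc (d ∸ k)) * Σ              ≡⟨ cong (_* Σ) (compositions-closedForm (suc d) d (d ∸ k) ≤-refl) ⟩
  (d C (d ∸ k)) * Σ                                           ≡⟨ cong (_* Σ) (sym (nCk≡nC[n∸k] k≤d)) ⟩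
  (d C k) * Σ                                                 ∎
  where
  open ≡-Reasoning
  Σ : ℕ
  Σ = sum (map (λ m → binomDiff (suc d * n + 1) m (suc d ∸ k ∸ m) * a (suc d) n m) (upTo (suc (suc d ∸ k))))
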